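{- Let $h\ge 2$ and let $m$ be a positive integer with $\omega=\omega(m)\ge 2$. Then there are $\mathrm{CC}_h[m]$-circuits of size $2^{O\left(n^{1/(\omega\lfloor h/2\rfloor)}\log n\right)}$ computing the $n$-ary conjunction $\mathrm{AND}_n$.
   Context: For $A\subseteq\{0,\dots,m-1\}$, the gate $\mathrm{MOD}_m^A$ (unbounded fan-in) outputs $1$ iff the sum of its boolean inputs modulo $m$ lies in $A$; multiple wires are allowed. A $\mathrm{CC}_h[m]$-circuit is a depth-$h$ circuit built of gates $\mathrm{MOD}_m^A$. Size is the number of gates. $\omega(m)$ is the number of distinct prime divisors of $m$. -}

module Defs where

open import Data.Nat using (ℕ; zero; suc; _+_; _*_; _⊔_; _≟_; _≤_; NonZero)
open import Data.Nat.DivMod using (_mod_)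
open import Data.Nat.Divisibility using (_∣?_)
open import Data.Nat.Primality using (prime?)
open import Data.Bool using (Bool; true; false; if_then_else_; _∧_)
open import Data.Fin using (Fin; splitAt; _↑ʳ_)
open import Relation.Binary.PropositionalEquality using (_≡_)
open import Data.Fin.Subset using (Subset)
open import Data.Vec using (lookup)
open import Data.Vec.Functional using (Vector; _∷_; foldr)
open import Data.Sum using (inj₁; inj₂)
open import Data.List using (List; length; filter; upTo)
open import Relation.Nullary.Decidable using (_×-dec_; ⌊_⌋)

ω : ℕ → ℕ
ω m = length (filter (λ p → prime? p ×-dec (p ∣? m)) (upTo (suc m)))

∑ : ∀ {k} → Vector ℕ k → ℕ
∑ = foldr _+_ 0

maxᶠ : ∀ {k} → Vector ℕ k → ℕ
maxᶠ = foldr _⊔_ 0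

-- A MOD_m^A gate whose possible input wires are w (= n inputs + earlier gates).
-- `wires i` is the number of wires from source i into this gate (multiple wires allowed).
record Gate (m w : ℕ) : Set where
  constructor modGate
  field
    accept : Subset m
    wires  : Fin w → ℕ

open Gate public

evalGate : ∀ {m w} .{{_ : NonZero m}} → Gate m w → (Fin w → Bool) → Bool
evalGate {m} g env =
  lookup (accept g) (∑ (λ i → if env i then wires g i else 0) mod m)

-- Gate number 0 of a nonempty list is the most recently added gate; a gate
-- added on top of k gates may read the n inputs (indices n ↑ˡ …) and the k
-- earlier gates (indices n ↑ʳ j), so the circuit is acyclic by construction.
infixr 5 _◁_
data Gates (m n : ℕ) : ℕ → Set where
  []  : Gates m n 0
  _◁_ : ∀ {k} → Gate m (n + k) → Gates m n k → Gates m n (suc k)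

env : ∀ {n k} → (Fin n → Bool) → (Fin k → Bool) → Fin (n + k) → Bool
env {n} x v i with splitAt n i
... | inj₁ a = x a
... | inj₂ b = v b

values : ∀ {m n k} .{{_ : NonZero m}} → Gates m n k → (Fin n → Bool) → Fin k → Bool
values []       x = λ ()
values (g ◁ gs) x = evalGate g (env x (values gs x)) ∷ values gs x

depths : ∀ {m n k} → Gates m n k → Fin k → ℕ
depths []       = λ ()
depths {n = n} (g ◁ gs) =
  suc (maxᶠ (λ j → if ⌊ wires g (n ↑ʳ j) ≟ 0 ⌋ then 0 else depths gs j)) ∷ depths gs

-- A circuit: a nonempty list of gates; the output gate is the last one added.
record Circuit (m n : ℕ) : Set where
  constructor circuit
  field
    k     : ℕ
    gates : Gates m n (suc k)

open Circuit public

size : ∀ {m n} → Circuit m n → ℕ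
size c = suc (k c)

depth : ∀ {m n} → Circuit m n → ℕ
depth c = maxᶠ (depths (gates c))

output : ∀ {m n} .{{_ : NonZero m}} → Circuit m n → (Fin n → Bool) → Bool
output c x = values (gates c) x Fin.zero

IsCC : ∀ {m n} → ℕ → Circuit m n → Set
IsCC h c = depth c ≤ h

ANDₙ : ∀ {n} → (Fin n → Bool) → Bool
ANDₙ = foldr _∧_ true

Computes : ∀ {m n} .{{_ : NonZero m}} → Circuit m n → ((Fin n → Bool) → Bool) → Set
Computes c f = ∀ x → output c x ≡ f x

-- Let s be the number of zeros among N inputs, and let p range over the r = ω(m) primes dividing m,
-- each paired with another prime q ∣ m. For a power P = pᵉ ≥ R the indicator g s = [P ∤ s] has
-- period P, and p divides every binomial coefficient C(P, j) with 0 < j < P, so p divides all P-th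
-- finite differences of g. Expanding g one input at a time then writes q^P · g s modulo p as an
-- integer combination of differences [W ≡ t] − [W ≡ t + 1] (mod q) of weighted input sums W, each
-- a single MOD_m gate because q ∣ m. One more MOD_m gate adds these combinations with Chinese
-- remainder weights and tests divisibility by ∏ p, which holds iff P ∣ s for every p, that is iff
-- s = 0 as soon as N < R^r. This depth-2 AND of fan-in N has 2^O(R log(mN)) gates with R ≈ N^(1/r);
-- nesting it K = ⌊h/2⌋ times with N ≈ n^(1/K) gives the bound.

module Submission where

module Compilation where

  open import Defs
  open import Data.Nat as ℕ using (ℕ; zero; suc; _+_; _*_; _⊔_; _≤_; z≤n; s≤s; NonZero)
  open import Data.Nat.Properties
  open import Data.Nat.DivMod using (_mod_)
  open import Data.Bool using (Bool; true; false; if_then_else_)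
  open import Data.Fin using (Fin; zero; suc; _↑ˡ_; _↑ʳ_; splitAt)
  import Data.Fin.Properties as Fin
  open import Data.Fin.Subset using (Subset)
  open import Data.Vec using (lookup)
  open import Data.List using (List; []; _∷_; length)
  open import Data.List.Relation.Unary.All as All using (All; []; _∷_)
  open import Data.Product using (_×_; _,_; Σ)
  open import Data.Sum using (_⊎_; inj₁; inj₂)
  open import Function using (_∘_)
  open import Data.Empty using (⊥)
  open import Data.Unit using (⊤)
  open import Relation.Binary.PropositionalEquality
  open import Relation.Nullary using (yes; no)
  open import Relation.Nullary.Decidable using (⌊_⌋)
  import Algebra.Properties.Semiring.Sum +-*-semiring as Sum

  ∑-indicator : ∀ {k} (s : Fin k) (v : ℕ) → ∑ (λ i → if ⌊ i Fin.≟ s ⌋ then v else 0) ≡ v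
  ∑-indicator {suc k} zero v = trans (cong (v +_) (Sum.sum-replicate-zero k)) (+-identityʳ v)
  ∑-indicator {suc k} (suc s) v = trans (Sum.sum-cong-≗ shift) (∑-indicator s v)
    where
    shift : ∀ i → (if ⌊ suc i Fin.≟ suc s ⌋ then v else 0) ≡ (if ⌊ i Fin.≟ s ⌋ then v else 0)
    shift i with i Fin.≟ s
    ... | yes refl = refl
    ... | no _ = refl

  maxᶠ-lub : ∀ {k} (f : Fin k → ℕ) {B : ℕ} → (∀ i → f i ≤ B) → maxᶠ f ≤ B
  maxᶠ-lub {zero} f h = z≤n
  maxᶠ-lub {suc k} f h = ⊔-lub (h zero) (maxᶠ-lub (f ∘ suc) (h ∘ suc))

  module FormulaCompilation (m : ℕ) .{{_ : NonZero m}} (n : ℕ) where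

    data Formula : Set where
      input : Fin n → Formula
      gate  : Subset m → List (ℕ × Formula) → Formula

    Args : Set
    Args = List (ℕ × Formula)

    mutual
      eval : Formula → (Fin n → Bool) → Bool
      eval (input i) x = x i
      eval (gate A cs) x = lookup A (argSum cs x mod m)

      argSum : Args → (Fin n → Bool) → ℕ
      argSum [] x = 0
      argSum ((c , f) ∷ cs) x = (if eval f x then c else 0) + argSum cs x

    mutual
      formulaDepth : Formula → ℕ
      formulaDepth (input _) = 0
      formulaDepth (gate A cs) = suc (argsDepth cs)

      argsDepth : Args → ℕ
      argsDepth [] = 0
      argsDepth ((c , f) ∷ cs) = formulaDepth f ⊔ argsDepth cs

    mutual
      gateCount : Formula → ℕ
      gateCount (input _) = 0
      gateCount (gate A cs) = suc (argsGateCount cs)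

      argsGateCount : Args → ℕ
      argsGateCount [] = 0
      argsGateCount ((c , f) ∷ cs) = gateCount f + argsGateCount cs

    infix 4 _⊑_
    data _⊑_ : ∀ {k k'} → Gates m n k → Gates m n k' → Set where
      stop : ∀ {k} {gs : Gates m n k} → gs ⊑ gs
      push : ∀ {k k'} {gs : Gates m n k} {gs' : Gates m n k'} (g : Gate m (n + k')) →
             gs ⊑ gs' → gs ⊑ g ◁ gs'

    ⊑-trans : ∀ {k₁ k₂ k₃} {gs₁ : Gates m n k₁} {gs₂ : Gates m n k₂} {gs₃ : Gates m n k₃} →
              gs₁ ⊑ gs₂ → gs₂ ⊑ gs₃ → gs₁ ⊑ gs₃
    ⊑-trans e stop = e
    ⊑-trans e (push g e') = push g (⊑-trans e e')

    liftGate : ∀ {k₁ k₂} {gs : Gates m n k₁} {gs' : Gates m n k₂} → gs ⊑ gs' → Fin k₁ → Fin k₂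
    liftGate stop j = j
    liftGate (push g e) j = suc (liftGate e j)

    values-liftGate : ∀ {k₁ k₂} {gs : Gates m n k₁} {gs' : Gates m n k₂} (e : gs ⊑ gs') x j →
      values gs' x (liftGate e j) ≡ values gs x j
    values-liftGate stop x j = refl
    values-liftGate (push g e) x j = values-liftGate e x j

    depths-liftGate : ∀ {k₁ k₂} {gs : Gates m n k₁} {gs' : Gates m n k₂} (e : gs ⊑ gs') j →
      depths gs' (liftGate e j) ≡ depths gs j
    depths-liftGate stop j = refl
    depths-liftGate (push g e) j = depths-liftGate e j

    liftSource : ∀ {k₁ k₂} {gs : Gates m n k₁} {gs' : Gates m n k₂} → gs ⊑ gs' → Fin (n + k₁) → Fin (n + k₂)
    liftSource {k₂ = k₂} e i with splitAt n i
    ... | inj₁ a = a ↑ˡ k₂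
    ... | inj₂ b = n ↑ʳ liftGate e b

    env-input : ∀ {k} (x : Fin n → Bool) (v : Fin k → Bool) a → env x v (a ↑ˡ k) ≡ x a
    env-input {k} x v a rewrite Fin.splitAt-↑ˡ n a k = refl

    env-gate : ∀ {k} (x : Fin n → Bool) (v : Fin k → Bool) b → env x v (n ↑ʳ b) ≡ v b
    env-gate {k} x v b rewrite Fin.splitAt-↑ʳ n k b = refl

    sourceDepth : ∀ {k} → Gates m n k → Fin (n + k) → ℕ
    sourceDepth gs i with splitAt n i
    ... | inj₁ _ = 0
    ... | inj₂ b = depths gs b

    sourceDepth-input : ∀ {k} (gs : Gates m n k) a → sourceDepth gs (a ↑ˡ k) ≡ 0
    sourceDepth-input {k} gs a rewrite Fin.splitAt-↑ˡ n a k = refl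

    sourceDepth-gate : ∀ {k} (gs : Gates m n k) b → sourceDepth gs (n ↑ʳ b) ≡ depths gs b
    sourceDepth-gate {k} gs b rewrite Fin.splitAt-↑ʳ n k b = refl

    module _ {k₁ k₂} {gs : Gates m n k₁} {gs' : Gates m n k₂} (e : gs ⊑ gs') where

      env-liftSource : ∀ x i → env x (values gs' x) (liftSource e i) ≡ env x (values gs x) i
      env-liftSource x i with splitAt n i
      ... | inj₁ a = env-input x _ a
      ... | inj₂ b = trans (env-gate x _ (liftGate e b)) (values-liftGate e x b)

      sourceDepth-liftSource : ∀ i → sourceDepth gs' (liftSource e i) ≡ sourceDepth gs i
      sourceDepth-liftSource i with splitAt n i
      ... | inj₁ a = sourceDepth-input gs' a
      ... | inj₂ b = trans (sourceDepth-gate gs' (liftGate e b)) (depths-liftGate e b)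

    Wiring : ℕ → Set
    Wiring k = List (ℕ × Fin (n + k))

    multiplicity : ∀ {k} → Wiring k → Fin (n + k) → ℕ
    multiplicity [] i = 0
    multiplicity ((c , s) ∷ ps) i = (if ⌊ i Fin.≟ s ⌋ then c else 0) + multiplicity ps i

    wiringSum : ∀ {k} → Wiring k → (Fin (n + k) → Bool) → ℕ
    wiringSum [] v = 0
    wiringSum ((c , s) ∷ ps) v = (if v s then c else 0) + wiringSum ps v

    SourcesBelow : ∀ {k} → Gates m n k → ℕ → Wiring k → Set
    SourcesBelow gs B = All (λ (_ , s) → sourceDepth gs s ≤ B)

    sourcesBelow-mono : ∀ {k} {gs : Gates m n k} {B B'} → B ≤ B' → ∀ {ps} →
      SourcesBelow gs B ps → SourcesBelow gs B' ps
    sourcesBelow-mono le = All.map (λ d → ≤-trans d le)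

    ∑-multiplicity : ∀ {k} (ps : Wiring k) (v : Fin (n + k) → Bool) →
      ∑ (λ i → if v i then multiplicity ps i else 0) ≡ wiringSum ps v
    ∑-multiplicity {k} [] v = trans (Sum.sum-cong-≗ (λ i → if-idem (v i))) (Sum.sum-replicate-zero (n + k))
      where
      if-idem : ∀ b → (if b then 0 else 0) ≡ 0
      if-idem true = refl
      if-idem false = refl
    ∑-multiplicity ((c , s) ∷ ps) v = begin
        ∑ (λ i → if v i then δ i c + multiplicity ps i else 0)
      ≡⟨ Sum.sum-cong-≗ (λ i → if-+ (v i) (δ i c) (multiplicity ps i)) ⟩
        ∑ (λ i → (if v i then δ i c else 0) + (if v i then multiplicity ps i else 0))
      ≡⟨ Sum.∑-distrib-+ (λ i → if v i then δ i c else 0) (λ i → if v i then multiplicity ps i else 0) ⟩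
        ∑ (λ i → if v i then δ i c else 0) + ∑ (λ i → if v i then multiplicity ps i else 0)
      ≡⟨ cong₂ _+_ (trans (Sum.sum-cong-≗ point) (∑-indicator s (if v s then c else 0)))
                   (∑-multiplicity ps v) ⟩
        (if v s then c else 0) + wiringSum ps v
      ∎
      where
      open ≡-Reasoning
      δ : Fin _ → ℕ → ℕ
      δ i w = if ⌊ i Fin.≟ s ⌋ then w else 0
      if-+ : ∀ b u w → (if b then u + w else 0) ≡ (if b then u else 0) + (if b then w else 0)
      if-+ true u w = refl
      if-+ false u w = refl
      point : ∀ i → (if v i then δ i c else 0) ≡ δ i (if v s then c else 0)
      point i with i Fin.≟ s
      ... | yes refl = refl
      ... | no _ with v i
      ... | true = refl
      ... | false = refl

    unwired-or-below : ∀ {k} (gs : Gates m n k) {B} (ps : Wiring k) → SourcesBelow gs B ps →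
      ∀ i → multiplicity ps i ≡ 0 ⊎ sourceDepth gs i ≤ B
    unwired-or-below gs [] _ i = inj₁ refl
    unwired-or-below gs ((c , s) ∷ ps) (d ∷ ds) i with i Fin.≟ s
    ... | yes refl = inj₂ d
    ... | no _ = unwired-or-below gs ps ds i

    wiredGate : ∀ {k} → Subset m → Wiring k → Gate m (n + k)
    wiredGate A ps = modGate A (multiplicity ps)

    wiredGate-depth : ∀ {k} (gs : Gates m n k) {B} (ps : Wiring k) → SourcesBelow gs B ps → ∀ A →
      depths (wiredGate A ps ◁ gs) zero ≤ suc B
    wiredGate-depth gs {B} ps below A =
      s≤s (maxᶠ-lub _ λ j → bound j (unwired-or-below gs ps below (n ↑ʳ j)))
      where
      bound : ∀ j → multiplicity ps (n ↑ʳ j) ≡ 0 ⊎ sourceDepth gs (n ↑ʳ j) ≤ B →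
              (if ⌊ multiplicity ps (n ↑ʳ j) ℕ.≟ 0 ⌋ then 0 else depths gs j) ≤ B
      bound j (inj₁ unwired) rewrite unwired = z≤n
      bound j (inj₂ below) with multiplicity ps (n ↑ʳ j) ℕ.≟ 0
      ... | yes _ = z≤n
      ... | no _ = subst (_≤ B) (sourceDepth-gate gs j) below

    wiredGate-value : ∀ {k} (gs : Gates m n k) (ps : Wiring k) A x →
      values (wiredGate A ps ◁ gs) x zero ≡ lookup A (wiringSum ps (env x (values gs x)) mod m)
    wiredGate-value gs ps A x = cong (λ s → lookup A (s mod m)) (∑-multiplicity ps (env x (values gs x)))

    record CompiledArgs {k} (gs : Gates m n k) (D : ℕ) (cs : Args) : Set where
      constructor compiledArgs
      field
        {k'}     : ℕ
        gates'   : Gates m n k'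
        extends  : gs ⊑ gates'
        wiring   : Wiring k'
        sound    : ∀ x → wiringSum wiring (env x (values gates' x)) ≡ argSum cs x
        shallow  : SourcesBelow gates' (argsDepth cs) wiring
        bounded  : ∀ j → depths gates' j ≤ D
        counted  : k' ≤ argsGateCount cs + k

    record Compiled {k} (gs : Gates m n k) (D : ℕ) (f : Formula) : Set where
      constructor compiled
      field
        {k'}     : ℕ
        gates'   : Gates m n k'
        extends  : gs ⊑ gates'
        source   : Fin (n + k')
        sound    : ∀ x → env x (values gates' x) source ≡ eval f x
        shallow  : sourceDepth gates' source ≤ formulaDepth f
        bounded  : ∀ j → depths gates' j ≤ D
        counted  : k' ≤ gateCount f + k

    mutual
      compile : ∀ {k} (f : Formula) (gs : Gates m n k) D →
        (∀ j → depths gs j ≤ D) → formulaDepth f ≤ D → Compiled gs D f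
      compile {k} (input i) gs D bounded _ =
        compiled gs stop (i ↑ˡ k) (λ x → env-input x _ i)
          (≤-reflexive (sourceDepth-input gs i)) bounded ≤-refl
      compile (gate A cs) gs D bounded fD
        with compileArgs cs gs D bounded (≤-trans (n≤1+n _) fD)
      ... | compiledArgs gs' ext ps sound shallow bounded' counted =
        compiled (wiredGate A ps ◁ gs') (push _ ext) (n ↑ʳ zero) sound'
          (subst (_≤ suc (argsDepth cs)) (sym (sourceDepth-gate (wiredGate A ps ◁ gs') zero)) top)
          bounded'' (s≤s counted)
        where
        top = wiredGate-depth gs' ps shallow A
        sound' : ∀ x → env x (values (wiredGate A ps ◁ gs') x) (n ↑ʳ zero) ≡ eval (gate A cs) x
        sound' x = begin
            env x (values (wiredGate A ps ◁ gs') x) (n ↑ʳ zero) ≡⟨ env-gate x _ zero ⟩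
            values (wiredGate A ps ◁ gs') x zero                ≡⟨ wiredGate-value gs' ps A x ⟩
            lookup A (wiringSum ps (env x (values gs' x)) mod m) ≡⟨ cong (λ s → lookup A (s mod m)) (sound x) ⟩
            eval (gate A cs) x                                  ∎
          where open ≡-Reasoning
        bounded'' : ∀ j → depths (wiredGate A ps ◁ gs') j ≤ D
        bounded'' zero = ≤-trans top fD
        bounded'' (suc j) = bounded' j

      compileArgs : ∀ {k} (cs : Args) (gs : Gates m n k) D →
        (∀ j → depths gs j ≤ D) → argsDepth cs ≤ D → CompiledArgs gs D cs
      compileArgs [] gs D bounded _ = compiledArgs gs stop [] (λ x → refl) [] bounded ≤-refl
      compileArgs ((c , f) ∷ cs) gs D bounded csD
        with compile f gs D bounded (≤-trans (m≤m⊔n _ _) csD)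
      ... | compiled gs₁ ext₁ s₁ sound₁ shallow₁ bounded₁ counted₁
        with compileArgs cs gs₁ D bounded₁ (≤-trans (m≤n⊔m (formulaDepth f) _) csD)
      ... | compiledArgs gs₂ ext₂ ps₂ sound₂ shallow₂ bounded₂ counted₂ =
        compiledArgs gs₂ (⊑-trans ext₁ ext₂) ((c , liftSource ext₂ s₁) ∷ ps₂)
          (λ x → cong₂ _+_ (cong (λ b → if b then c else 0) (trans (env-liftSource ext₂ x s₁) (sound₁ x)))
                           (sound₂ x))
          (≤-trans (≤-reflexive (sourceDepth-liftSource ext₂ s₁)) (≤-trans shallow₁ (m≤m⊔n _ _))
            ∷ sourcesBelow-mono (m≤n⊔m (formulaDepth f) _) shallow₂)
          bounded₂
          (≤-trans counted₂ (≤-trans (+-monoʳ-≤ (argsGateCount cs) counted₁)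
            (≤-reflexive (+-rotate (argsGateCount cs) (gateCount f) _))))
        where
        +-rotate : ∀ a b c → a + (b + c) ≡ b + a + c
        +-rotate a b c = trans (sym (+-assoc a b c)) (cong (_+ c) (+-comm a b))

    IsGate : Formula → Set
    IsGate (input _) = ⊥
    IsGate (gate _ _) = ⊤

    formulaCircuit : (f : Formula) → {IsGate f} →
      Σ (Circuit m n) λ c → size c ≤ gateCount f × depth c ≤ formulaDepth f × (∀ x → output c x ≡ eval f x)
    formulaCircuit (gate A cs) with compileArgs cs [] (argsDepth cs) (λ ()) ≤-refl
    ... | compiledArgs {k'} gs _ ps sound shallow bounded counted =
      circuit k' (wiredGate A ps ◁ gs) ,
      s≤s (subst (k' ≤_) (+-identityʳ _) counted) ,
      maxᶠ-lub (depths (wiredGate A ps ◁ gs)) bounded' ,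
      (λ x → trans (wiredGate-value gs ps A x) (cong (λ s → lookup A (s mod m)) (sound x)))
      where
      bounded' : ∀ j → depths (wiredGate A ps ◁ gs) j ≤ suc (argsDepth cs)
      bounded' zero = wiredGate-depth gs ps shallow A
      bounded' (suc j) = m≤n⇒m≤1+n (bounded j)

    argsGateCount-uniform : ∀ {c} (cs : Args) → All (λ (_ , f) → gateCount f ≡ c) cs → argsGateCount cs ≡ length cs * c
    argsGateCount-uniform [] [] = refl
    argsGateCount-uniform ((_ , f) ∷ cs) (eq ∷ eqs) = cong₂ _+_ eq (argsGateCount-uniform cs eqs)

    argsDepth-bound : ∀ {B} (cs : Args) → All (λ (_ , f) → formulaDepth f ≤ B) cs → argsDepth cs ≤ B
    argsDepth-bound [] [] = z≤n
    argsDepth-bound ((_ , f) ∷ cs) (le ∷ les) = ⊔-lub le (argsDepth-bound cs les)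

module Binomials where

  open import Data.Nat
  open import Data.Nat.Properties
  open import Data.Nat.Combinatorics using (_C_; nCk+nC[k+1]≡[n+1]C[k+1]; nC1≡n)
  open import Data.Nat.Divisibility
  open import Data.Nat.Primality using (Prime; euclidsLemma; prime⇒nonZero)
  open import Data.Nat.Tactic.RingSolver using (solve-∀)
  open import Data.Empty using (⊥-elim)
  open import Data.Sum using (inj₁; inj₂)
  open import Relation.Binary.PropositionalEquality
  open import Relation.Nullary using (¬_; yes; no)

  prime-power-∣-cancelʳ : ∀ {p c} → Prime p → ¬ p ∣ c → ∀ e j → p ^ e ∣ j * c → p ^ e ∣ j
  prime-power-∣-cancelʳ pr p∤c zero j _ = 1∣ j
  prime-power-∣-cancelʳ {p} {c} pr p∤c (suc e) j pᵉ⁺¹∣jc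
    with euclidsLemma j c pr (∣-trans (m∣m*n (p ^ e)) pᵉ⁺¹∣jc)
  ... | inj₂ p∣c = ⊥-elim (p∤c p∣c)
  ... | inj₁ (divides q refl) =
    ∣-trans (*-monoʳ-∣ p (prime-power-∣-cancelʳ pr p∤c e q pᵉ∣qc)) (∣-reflexive (*-comm p q))
    where
    instance _ = prime⇒nonZero pr
    pᵉ∣qc : p ^ e ∣ q * c
    pᵉ∣qc = *-cancelˡ-∣ p (subst (p * p ^ e ∣_) (trans (cong (_* c) (*-comm q p)) (*-assoc p q c)) pᵉ⁺¹∣jc)

  pascal : ∀ n k → suc n C suc k ≡ n C k + n C suc k
  pascal n k = sym (nCk+nC[k+1]≡[n+1]C[k+1] n k)

  C-vanishes : ∀ n k → n < k → n C k ≡ 0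
  C-vanishes zero (suc k) _ = refl
  C-vanishes (suc n) (suc k) (s≤s n<k) =
    trans (pascal n k) (cong₂ _+_ (C-vanishes n k n<k) (C-vanishes n (suc k) (m≤n⇒m≤1+n n<k)))

  C-absorption : ∀ n k → suc k * (suc n C suc k) ≡ suc n * (n C k)
  C-absorption zero zero = refl
  C-absorption zero (suc k) = *-zeroʳ (suc (suc k))
  C-absorption (suc n) zero = begin
    1 * (suc (suc n) C 1)  ≡⟨ *-identityˡ _ ⟩
    suc (suc n) C 1        ≡⟨ nC1≡n (suc (suc n)) ⟩
    suc (suc n)            ≡⟨ sym (*-identityʳ (suc (suc n))) ⟩
    suc (suc n) * 1        ∎
    where open ≡-Reasoning
  C-absorption (suc n) (suc k) = begin
    suc (suc k) * (suc (suc n) C suc (suc k))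
      ≡⟨ cong (suc (suc k) *_) (pascal (suc n) (suc k)) ⟩
    suc (suc k) * (suc n C suc k + suc n C suc (suc k))
      ≡⟨ *-distribˡ-+ (suc (suc k)) (suc n C suc k) _ ⟩
    (suc n C suc k + suc k * (suc n C suc k)) + suc (suc k) * (suc n C suc (suc k))
      ≡⟨ cong₂ (λ u v → (suc n C suc k + u) + v) (C-absorption n k) (C-absorption n (suc k)) ⟩
    (suc n C suc k + suc n * (n C k)) + suc n * (n C suc k)
      ≡⟨ cong (λ u → (u + suc n * (n C k)) + suc n * (n C suc k)) (pascal n k) ⟩
    ((n C k + n C suc k) + suc n * (n C k)) + suc n * (n C suc k)
      ≡⟨ regroup (n C k) (n C suc k) n ⟩
    suc (suc n) * (n C k + n C suc k)
      ≡⟨ cong (suc (suc n) *_) (sym (pascal n k)) ⟩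
    suc (suc n) * (suc n C suc k) ∎
    where
    open ≡-Reasoning
    regroup : ∀ a b n → ((a + b) + suc n * a) + suc n * b ≡ suc (suc n) * (a + b)
    regroup = solve-∀

  -- (j+1)·C(pᵉ, j+1) = pᵉ·C(pᵉ−1, j): if p ∤ C(pᵉ, j+1), all of pᵉ would have to divide j+1 < pᵉ.
  prime-∣-C-prime-power : ∀ {p} → Prime p → ∀ e j → 0 < j → j < p ^ e → p ∣ p ^ e C j
  prime-∣-C-prime-power {p} pr e (suc i) _ i<pᵉ with p ^ e in pᵉ≡ | p ∣? (p ^ e C suc i)
  ... | zero  | _ = ⊥-elim (<⇒≱ i<pᵉ z≤n)
  ... | suc Q | yes p∣C = p∣C
  ... | suc Q | no p∤C = ⊥-elim (<⇒≱ i<pᵉ (∣⇒≤ pᵉ∣1+i))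
    where
    pᵉ∣1+i·C : p ^ e ∣ suc i * (suc Q C suc i)
    pᵉ∣1+i·C = divides (Q C i) (begin
      suc i * (suc Q C suc i)  ≡⟨ C-absorption Q i ⟩
      suc Q * (Q C i)          ≡⟨ *-comm (suc Q) (Q C i) ⟩
      (Q C i) * suc Q          ≡⟨ cong ((Q C i) *_) (sym pᵉ≡) ⟩
      (Q C i) * p ^ e          ∎)
      where open ≡-Reasoning
    pᵉ∣1+i : suc Q ∣ suc i
    pᵉ∣1+i = subst (_∣ suc i) pᵉ≡ (prime-power-∣-cancelʳ pr p∤C e (suc i) pᵉ∣1+i·C)

module FiniteDifferences where

  open Binomials
  open import Data.Nat as ℕ using (ℕ; zero; suc; _<_; z≤n; s≤s)
  import Data.Nat.Properties as ℕ
  open import Data.Nat.Combinatorics using (_C_; nCn≡1)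
  open import Data.Nat.Divisibility using (divides) renaming (_∣_ to _∣ℕ_)
  open import Data.Nat.Primality using (Prime; prime⇒irreducible; prime⇒nonZero)
  open import Data.Integer using (ℤ; +_; -_; _+_; _-_; _*_)
  import Data.Integer.Properties as ℤ
  open import Data.Integer.Divisibility.Signed using (_∣_; divides; ∣ᵤ⇒∣; ∣m∣n⇒∣m+n; ∣m⇒∣m*n; ∣n⇒∣m*n)
  open import Data.Integer.Tactic.RingSolver using (solve-∀)
  import Data.Nat.Tactic.RingSolver as ℕ-Solver
  open import Data.Empty using (⊥-elim)
  open import Data.Product using (∃; _,_)
  open import Data.Sum using (_⊎_; inj₁; inj₂)
  open import Function using (_∘_)
  open import Relation.Binary.PropositionalEquality

  σ : ℕ → (ℕ → ℤ) → ℤ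
  σ zero f = + 0
  σ (suc n) f = f 0 + σ n (f ∘ suc)

  σ-cong : ∀ n {f g : ℕ → ℤ} → (∀ j → j < n → f j ≡ g j) → σ n f ≡ σ n g
  σ-cong zero eq = refl
  σ-cong (suc n) eq = cong₂ _+_ (eq 0 (s≤s z≤n)) (σ-cong n (λ j j<n → eq (suc j) (s≤s j<n)))

  σ-last : ∀ n f → σ (suc n) f ≡ σ n f + f n
  σ-last zero f = trans (ℤ.+-identityʳ (f 0)) (sym (ℤ.+-identityˡ (f 0)))
  σ-last (suc n) f = trans (cong (_+_ (f 0)) (σ-last n (f ∘ suc))) (sym (ℤ.+-assoc (f 0) _ _))

  σ-distrib-- : ∀ n f g → σ n (λ j → f j - g j) ≡ σ n f - σ n g
  σ-distrib-- zero f g = refl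
  σ-distrib-- (suc n) f g =
    trans (cong (_+_ (f 0 - g 0)) (σ-distrib-- n (f ∘ suc) (g ∘ suc)))
          (interchange (f 0) (g 0) (σ n (f ∘ suc)) (σ n (g ∘ suc)))
    where
    interchange : ∀ a b c d → (a - b) + (c - d) ≡ (a + c) - (b + d)
    interchange = solve-∀

  σ-const : ∀ n c → σ n (λ _ → c) ≡ + n * c
  σ-const zero c = sym (ℤ.*-zeroˡ c)
  σ-const (suc n) c = trans (cong (_+_ c) (σ-const n c)) (sym (ℤ.suc-* (+ n) c))

  *-distribˡ-σ : ∀ n c f → σ n (λ j → c * f j) ≡ c * σ n f
  *-distribˡ-σ zero c f = sym (ℤ.*-zeroʳ c)
  *-distribˡ-σ (suc n) c f =
    trans (cong (_+_ (c * f 0)) (*-distribˡ-σ n c (f ∘ suc))) (sym (ℤ.*-distribˡ-+ c (f 0) _))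

  ∣-σ : ∀ {d} n f → (∀ j → j < n → d ∣ f j) → d ∣ σ n f
  ∣-σ zero f _ = divides (+ 0) refl
  ∣-σ (suc n) f d∣f = ∣m∣n⇒∣m+n (d∣f 0 (s≤s z≤n)) (∣-σ n (f ∘ suc) (λ j j<n → d∣f (suc j) (s≤s j<n)))

  minusOne^ : ℕ → ℤ
  minusOne^ zero = + 1
  minusOne^ (suc zero) = - + 1
  minusOne^ (suc (suc k)) = minusOne^ k

  minusOne^-suc : ∀ k → minusOne^ (suc k) ≡ - minusOne^ k
  minusOne^-suc zero = refl
  minusOne^-suc (suc zero) = refl
  minusOne^-suc (suc (suc k)) = minusOne^-suc k

  minusOne^-even : ∀ k → minusOne^ (k ℕ.+ k) ≡ + 1
  minusOne^-even zero = refl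
  minusOne^-even (suc k) = trans (cong (minusOne^ ∘ suc) (ℕ.+-suc k k)) (minusOne^-even k)

  minusOne^-odd : ∀ k → minusOne^ (suc (k ℕ.+ k)) ≡ - + 1
  minusOne^-odd k = trans (minusOne^-suc (k ℕ.+ k)) (cong -_ (minusOne^-even k))

  Δ : (ℕ → ℤ) → (ℕ → ℤ)
  Δ g s = g (suc s) - g s

  Δ^ : ℕ → (ℕ → ℤ) → (ℕ → ℤ)
  Δ^ zero g = g
  Δ^ (suc b) g = Δ^ b (Δ g)

  coefficient : ℕ → ℕ → ℤ
  coefficient n j = minusOne^ (n ℕ.+ j) * + (n C j)

  expansion : ℕ → (ℕ → ℤ) → (ℕ → ℤ)
  expansion n g s = σ (suc n) (λ j → coefficient n j * g (s ℕ.+ j))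

  expansion-step : ∀ n g s → expansion (suc n) g s ≡ expansion n g (suc s) - expansion n g s
  expansion-step n g s = begin
      F 0 + σ (suc n) (F ∘ suc)
    ≡⟨ cong₂ _+_ F0 (trans (σ-cong (suc n) (λ j _ → F-suc j)) (σ-distrib-- (suc n) shifted dropped)) ⟩
      - A + (X - σ (suc n) dropped)
    ≡⟨ cong (λ z → - A + (X - z)) (trans (σ-last n dropped) (cong (_+_ Y) dropped-last)) ⟩
      - A + (X - (Y + + 0))
    ≡⟨ regroup A X Y ⟩
      X - (A + Y)
    ∎
    where
    open ≡-Reasoning
    F : ℕ → ℤ
    F j = coefficient (suc n) j * g (s ℕ.+ j)
    shifted dropped : ℕ → ℤ
    shifted j = coefficient n j * g (suc s ℕ.+ j)
    dropped j = coefficient n (suc j) * g (s ℕ.+ suc j)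
    A = coefficient n 0 * g (s ℕ.+ 0)
    X = expansion n g (suc s)
    Y = σ n dropped
    F0 : F 0 ≡ - A
    F0 = trans (cong (λ z → z * + 1 * g (s ℕ.+ 0)) (minusOne^-suc (n ℕ.+ 0)))
               (neg-assoc (minusOne^ (n ℕ.+ 0)) (+ 1) (g (s ℕ.+ 0)))
      where
      neg-assoc : ∀ a b x → (- a) * b * x ≡ - (a * b * x)
      neg-assoc = solve-∀
    F-suc : ∀ j → F (suc j) ≡ shifted j - dropped j
    F-suc j = begin
        minusOne^ (suc n ℕ.+ suc j) * + (suc n C suc j) * g (s ℕ.+ suc j)
      ≡⟨ cong₂ (λ a b → minusOne^ a * + b * g (s ℕ.+ suc j)) (cong suc (ℕ.+-suc n j)) (pascal n j) ⟩
        minusOne^ (n ℕ.+ j) * (+ (n C j) + + (n C suc j)) * g (s ℕ.+ suc j)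
      ≡⟨ split (minusOne^ (n ℕ.+ j)) (+ (n C j)) (+ (n C suc j)) (g (s ℕ.+ suc j)) ⟩
        minusOne^ (n ℕ.+ j) * + (n C j) * g (s ℕ.+ suc j) - (- minusOne^ (n ℕ.+ j)) * + (n C suc j) * g (s ℕ.+ suc j)
      ≡⟨ cong₂ (λ a b → minusOne^ (n ℕ.+ j) * + (n C j) * g b - a * + (n C suc j) * g (s ℕ.+ suc j))
               (sym (trans (cong minusOne^ (ℕ.+-suc n j)) (minusOne^-suc (n ℕ.+ j)))) (ℕ.+-suc s j) ⟩
        shifted j - dropped j
      ∎
      where
      split : ∀ a b c x → a * (b + c) * x ≡ a * b * x - (- a) * c * x
      split = solve-∀
    dropped-last : dropped n ≡ + 0
    dropped-last rewrite C-vanishes n (suc n) (ℕ.n<1+n n) =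
      cong (_* g (s ℕ.+ suc n)) (ℤ.*-zeroʳ (minusOne^ (n ℕ.+ suc n)))
    regroup : ∀ a x y → - a + (x - (y + + 0)) ≡ x - (a + y)
    regroup = solve-∀

  Δ^≡expansion : ∀ n g s → Δ^ n g s ≡ expansion n g s
  Δ^≡expansion zero g s =
    sym (trans (ℤ.+-identityʳ _) (trans (ℤ.*-identityˡ (g (s ℕ.+ 0))) (cong g (ℕ.+-identityʳ s))))
  Δ^≡expansion (suc n) g s = begin
      Δ^ n (Δ g) s
    ≡⟨ Δ^≡expansion n (Δ g) s ⟩
      σ (suc n) (λ j → coefficient n j * (g (suc (s ℕ.+ j)) - g (s ℕ.+ j)))
    ≡⟨ σ-cong (suc n) (λ j _ → distrib (coefficient n j) (g (suc s ℕ.+ j)) (g (s ℕ.+ j))) ⟩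
      σ (suc n) (λ j → coefficient n j * g (suc s ℕ.+ j) - coefficient n j * g (s ℕ.+ j))
    ≡⟨ σ-distrib-- (suc n) (λ j → coefficient n j * g (suc s ℕ.+ j)) (λ j → coefficient n j * g (s ℕ.+ j)) ⟩
      expansion n g (suc s) - expansion n g s
    ≡⟨ sym (expansion-step n g s) ⟩
      expansion (suc n) g s
    ∎
    where
    open ≡-Reasoning
    distrib : ∀ a b c → a * (b - c) ≡ a * b - a * c
    distrib = solve-∀

  even-or-odd : ∀ n → ∃ λ t → n ≡ t ℕ.+ t ⊎ n ≡ suc (t ℕ.+ t)
  even-or-odd zero = 0 , inj₁ refl
  even-or-odd (suc n) with even-or-odd n
  ... | t , inj₁ refl = t , inj₂ refl
  ... | t , inj₂ refl = suc t , inj₁ (cong suc (sym (ℕ.+-suc t t)))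

  odd-^ : ∀ t e → ∃ λ w → suc (t ℕ.+ t) ℕ.^ e ≡ suc (w ℕ.+ w)
  odd-^ t zero = 0 , refl
  odd-^ t (suc e) with odd-^ t e
  ... | w , eq = w ℕ.+ t ℕ.* suc (w ℕ.+ w) , trans (cong (suc (t ℕ.+ t) ℕ.*_) eq) (expand t w)
    where
    expand : ∀ t w → suc (t ℕ.+ t) ℕ.* suc (w ℕ.+ w) ≡
                     suc ((w ℕ.+ t ℕ.* suc (w ℕ.+ w)) ℕ.+ (w ℕ.+ t ℕ.* suc (w ℕ.+ w)))
    expand = ℕ-Solver.solve-∀

  2∣minusOne^+1 : ∀ k → + 2 ∣ minusOne^ k + + 1
  2∣minusOne^+1 zero = divides (+ 1) refl
  2∣minusOne^+1 (suc zero) = divides (+ 0) refl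
  2∣minusOne^+1 (suc (suc k)) = 2∣minusOne^+1 k

  prime-∣-minusOne^[prime^e]+1 : ∀ {p} → Prime p → ∀ e → + p ∣ minusOne^ (p ℕ.^ e) + + 1
  prime-∣-minusOne^[prime^e]+1 {p} pr e with even-or-odd p
  ... | t , inj₂ refl with odd-^ t e
  ...   | w , pᵉ≡ rewrite pᵉ≡ | minusOne^-odd w = divides (+ 0) refl
  prime-∣-minusOne^[prime^e]+1 {p} pr e | t , inj₁ p≡t+t
    with prime⇒irreducible pr (divides t (trans p≡t+t (t+t≡t*2 t)))
    where
    t+t≡t*2 : ∀ t → t ℕ.+ t ≡ t ℕ.* 2
    t+t≡t*2 = ℕ-Solver.solve-∀
  ... | inj₁ ()
  ... | inj₂ refl = 2∣minusOne^+1 (2 ℕ.^ e)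

  -- Modulo p only the end terms of the expansion survive; by periodicity they add up to ((−1)^(pᵉ) + 1)·g s.
  prime-∣-Δ^-periodic : ∀ {p} → Prime p → ∀ e (g : ℕ → ℤ) → (∀ s → g (s ℕ.+ p ℕ.^ e) ≡ g s) →
    ∀ s → + p ∣ Δ^ (p ℕ.^ e) g s
  prime-∣-Δ^-periodic {p} pr e g periodic s rewrite Δ^≡expansion (p ℕ.^ e) g s with p ℕ.^ e in pᵉ≡
  ... | zero = ⊥-elim (ℕ.≢-nonZero⁻¹ (p ℕ.^ e) {{ℕ.m^n≢0 p e {{prime⇒nonZero pr}}}} pᵉ≡)
  ... | suc Q = subst (+ p ∣_) (sym ends) (∣m∣n⇒∣m+n (∣m⇒∣m*n (g s) p∣minusOne^+1) p∣middle)
    where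
    F : ℕ → ℤ
    F j = coefficient (suc Q) j * g (s ℕ.+ j)
    middle = σ Q (F ∘ suc)
    p∣minusOne^+1 : + p ∣ minusOne^ (suc Q) + + 1
    p∣minusOne^+1 = subst (λ P → + p ∣ minusOne^ P + + 1) pᵉ≡ (prime-∣-minusOne^[prime^e]+1 pr e)
    p∣middle : + p ∣ middle
    p∣middle = ∣-σ Q (F ∘ suc) λ j j<Q →
      ∣m⇒∣m*n (g (s ℕ.+ suc j)) (∣n⇒∣m*n (minusOne^ (suc Q ℕ.+ suc j)) (∣ᵤ⇒∣
        (subst (λ P → p ∣ℕ P C suc j) pᵉ≡
          (prime-∣-C-prime-power pr e (suc j) (s≤s z≤n) (subst (suc j <_) (sym pᵉ≡) (s≤s j<Q))))))
    first : F 0 ≡ minusOne^ (suc Q) * g s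
    first = trans (cong₂ (λ a b → minusOne^ a * + 1 * g b) (ℕ.+-identityʳ (suc Q)) (ℕ.+-identityʳ s))
                  (cong (_* g s) (ℤ.*-identityʳ (minusOne^ (suc Q))))
    last : F (suc Q) ≡ g s
    last = begin
        minusOne^ (suc Q ℕ.+ suc Q) * + (suc Q C suc Q) * g (s ℕ.+ suc Q)
      ≡⟨ cong₂ (λ a b → a * + b * g (s ℕ.+ suc Q)) (minusOne^-even (suc Q)) (nCn≡1 (suc Q)) ⟩
        + 1 * + 1 * g (s ℕ.+ suc Q)
      ≡⟨ ℤ.*-identityˡ (g (s ℕ.+ suc Q)) ⟩
        g (s ℕ.+ suc Q)
      ≡⟨ periodic s ⟩
        g s
      ∎
      where open ≡-Reasoning
    ends : expansion (suc Q) g s ≡ (minusOne^ (suc Q) + + 1) * g s + middle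
    ends = trans (cong (_+_ (F 0)) (σ-last Q (F ∘ suc)))
                 (trans (cong₂ (λ a b → a + (middle + b)) first last) (regroup (minusOne^ (suc Q)) (g s) middle))
      where
      regroup : ∀ a x y → a * x + (y + x) ≡ (a + + 1) * x + y
      regroup = solve-∀

module ResidueRepresentation where

  open import Defs using (∑; ANDₙ)
  open FiniteDifferences
  open import Data.Nat as ℕ using (ℕ; zero; suc; _<_; _≤_; z≤n; s≤s; NonZero)
  import Data.Nat.Properties as ℕ
  open import Data.Nat.DivMod using (_%_; m<n⇒m%n≡m; [m+n]%n≡m%n; m%n<n)
  open import Data.Integer using (ℤ; +_; -_; _+_; _-_; _*_)
  import Data.Integer.Properties as ℤ
  open import Data.Integer.Divisibility.Signed using (_∣_; divides; ∣m∣n⇒∣m+n; ∣n⇒∣m*n; ∣m⇒∣-m)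
  open import Data.Integer.Tactic.RingSolver using (solve-∀)
  open import Algebra.Properties.AbelianGroup ℤ.+-0-abelianGroup using (∙-cancelˡ)
  open import Data.Bool using (Bool; true; false; if_then_else_)
  open import Data.Fin using (Fin; zero; suc)
  open import Data.List using (List; []; _∷_; _++_; map; applyUpTo; length)
  import Data.List.Properties as List
  open import Data.Product using (_×_; _,_)
  open import Data.Sum using (inj₁; inj₂)
  open import Data.Empty using (⊥-elim)
  open import Function using (_∘_)
  open import Relation.Binary.PropositionalEquality
  open import Relation.Nullary using (yes; no)
  open import Relation.Nullary.Decidable using (⌊_⌋)

  zeros : ∀ {N} → (Fin N → Bool) → ℕ
  zeros {zero} y = 0
  zeros {suc N} y = (if y zero then 0 else 1) ℕ.+ zeros (y ∘ suc)

  χ : Bool → ℤ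
  χ true = + 1
  χ false = + 0

  χ-≟-refl : ∀ a → χ ⌊ a ℕ.≟ a ⌋ ≡ + 1
  χ-≟-refl a with a ℕ.≟ a
  ... | yes _ = refl
  ... | no a≢a = ⊥-elim (a≢a refl)

  χ-≟-≢ : ∀ {a b} → a ≢ b → χ ⌊ a ℕ.≟ b ⌋ ≡ + 0
  χ-≟-≢ {a} {b} a≢b with a ℕ.≟ b
  ... | yes a≡b = ⊥-elim (a≢b a≡b)
  ... | no _ = refl

  σ-χ-≟ : ∀ n u → u < n → σ n (λ a → χ ⌊ a ℕ.≟ u ⌋) ≡ + 1
  σ-χ-≟ (suc n) u u<1+n with ℕ.m≤n⇒m<n∨m≡n (ℕ.≤-pred u<1+n)
  ... | inj₁ u<n = begin
      σ (suc n) (λ a → χ ⌊ a ℕ.≟ u ⌋)           ≡⟨ σ-last n _ ⟩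
      σ n (λ a → χ ⌊ a ℕ.≟ u ⌋) + χ ⌊ n ℕ.≟ u ⌋ ≡⟨ cong₂ _+_ (σ-χ-≟ n u u<n) (χ-≟-≢ (ℕ.>⇒≢ u<n)) ⟩
      + 1                                       ∎
    where open ≡-Reasoning
  ... | inj₂ refl = begin
      σ (suc u) (λ a → χ ⌊ a ℕ.≟ u ⌋)           ≡⟨ σ-last u _ ⟩
      σ u (λ a → χ ⌊ a ℕ.≟ u ⌋) + χ ⌊ u ℕ.≟ u ⌋ ≡⟨ cong₂ _+_ (σ-zero u) (χ-≟-refl u) ⟩
      + 1                                       ∎
    where
    open ≡-Reasoning
    σ-zero : ∀ u → σ u (λ a → χ ⌊ a ℕ.≟ u ⌋) ≡ + 0
    σ-zero u = trans (σ-cong u (λ a a<u → χ-≟-≢ (ℕ.<⇒≢ a<u))) (trans (σ-const u (+ 0)) (ℤ.*-zeroʳ (+ u)))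

  module Modulo (q : ℕ) .{{_ : NonZero q}} where

    residueCount : ℕ → ℕ → ℤ
    residueCount u W = σ q (λ a → χ ⌊ (a ℕ.+ W) % q ℕ.≟ u ⌋)

    residueCount-suc : ∀ u W → residueCount u (suc W) ≡ residueCount u W
    residueCount-suc u W = ∙-cancelˡ (f 0) _ _ (begin
          f 0 + residueCount u (suc W)
        ≡⟨ cong (_+_ (f 0)) (σ-cong q (λ a _ → cong (λ z → χ ⌊ z % q ℕ.≟ u ⌋) (ℕ.+-suc a W))) ⟩
          σ (suc q) f
        ≡⟨ σ-last q f ⟩
          residueCount u W + f q
        ≡⟨ cong (_+_ (residueCount u W)) wrap ⟩
          residueCount u W + f 0
        ≡⟨ ℤ.+-comm (residueCount u W) (f 0) ⟩
          f 0 + residueCount u W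
        ∎)
      where
      open ≡-Reasoning
      f : ℕ → ℤ
      f a = χ ⌊ (a ℕ.+ W) % q ℕ.≟ u ⌋
      wrap : f q ≡ f 0
      wrap = cong (λ z → χ ⌊ z ℕ.≟ u ⌋) (trans (cong (_% q) (ℕ.+-comm q W)) ([m+n]%n≡m%n W q))

    residueCount≡1 : ∀ u W → u < q → residueCount u W ≡ + 1
    residueCount≡1 u zero u<q =
      trans (σ-cong q (λ a a<q → cong (λ z → χ ⌊ z ℕ.≟ u ⌋) (trans (cong (_% q) (ℕ.+-identityʳ a)) (m<n⇒m%n≡m a<q))))
            (σ-χ-≟ q u u<q)
    residueCount≡1 u (suc W) u<q = trans (residueCount-suc u W) (residueCount≡1 u W u<q)

    weight : ∀ {N} → (Fin N → ℕ) → (Fin N → Bool) → ℕ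
    weight w y = ∑ (λ i → if y i then w i else 0)

    hits : ∀ {N} → (Fin N → ℕ) → ℕ → (Fin N → Bool) → Bool
    hits w r y = ⌊ weight w y % q ℕ.≟ r % q ⌋

    residueStep : ∀ {N} → (Fin N → ℕ) → ℕ → (Fin N → Bool) → ℤ
    residueStep w r y = χ (hits w r y) - χ (hits w (suc r) y)

    _◂_ : ∀ {N} → ℕ → (Fin N → ℕ) → Fin (suc N) → ℕ
    (a ◂ w) zero = a
    (a ◂ w) (suc i) = w i

    residueStep-0◂ : ∀ {N} (w : Fin N → ℕ) r y → residueStep (0 ◂ w) r y ≡ residueStep w r (y ∘ suc)
    residueStep-0◂ w r y with y zero
    ... | true = refl
    ... | false = refl

    -- Summing over all weights a of a new input kills the term when that input is 1,
    -- since every residue class is then hit exactly once.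
    σ-residueStep-◂ : ∀ {N} (w : Fin N → ℕ) r y →
      σ q (λ a → residueStep (a ◂ w) r y) ≡ (if y zero then + 0 else + q * residueStep w r (y ∘ suc))
    σ-residueStep-◂ w r y with y zero
    ... | true = trans (σ-distrib-- q _ _)
                   (cong₂ _-_ (residueCount≡1 (r % q) W (m%n<n r q)) (residueCount≡1 (suc r % q) W (m%n<n (suc r) q)))
      where W = weight w (y ∘ suc)
    ... | false = σ-const q (residueStep w r (y ∘ suc))

    Term : ℕ → Set
    Term N = ℤ × (Fin N → ℕ) × ℕ

    termValue : ∀ {N} → Term N → (Fin N → Bool) → ℤ
    termValue (c , w , r) y = c * residueStep w r y

    termsValue : ∀ {N} → List (Term N) → (Fin N → Bool) → ℤ
    termsValue [] y = + 0
    termsValue (t ∷ ts) y = termValue t y + termsValue ts y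

    termsValue-++ : ∀ {N} (ts us : List (Term N)) y → termsValue (ts ++ us) y ≡ termsValue ts y + termsValue us y
    termsValue-++ [] us y = sym (ℤ.+-identityˡ _)
    termsValue-++ (t ∷ ts) us y =
      trans (cong (_+_ (termValue t y)) (termsValue-++ ts us y)) (sym (ℤ.+-assoc (termValue t y) _ _))

    termsValue-applyUpTo : ∀ {N} n (f : ℕ → Term N) y → termsValue (applyUpTo f n) y ≡ σ n (λ a → termValue (f a) y)
    termsValue-applyUpTo zero f y = refl
    termsValue-applyUpTo (suc n) f y = cong (_+_ (termValue (f 0) y)) (termsValue-applyUpTo n (f ∘ suc) y)

    pad : ∀ {N} → List (Term N) → List (Term (suc N))
    pad = map (λ (c , w , r) → c , 0 ◂ w , r)

    termsValue-pad : ∀ {N} (ts : List (Term N)) y → termsValue (pad ts) y ≡ termsValue ts (y ∘ suc)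
    termsValue-pad [] y = refl
    termsValue-pad ((c , w , r) ∷ ts) y = cong₂ (λ a b → c * a + b) (residueStep-0◂ w r y) (termsValue-pad ts y)

    branch : ∀ {N} → List (Term N) → List (Term (suc N))
    branch [] = []
    branch ((c , w , r) ∷ ts) = applyUpTo (λ a → c , a ◂ w , r) q ++ branch ts

    termsValue-branch : ∀ {N} (ts : List (Term N)) y →
      termsValue (branch ts) y ≡ (if y zero then + 0 else + q * termsValue ts (y ∘ suc))
    termsValue-branch [] y with y zero
    ... | true = refl
    ... | false = sym (ℤ.*-zeroʳ (+ q))
    termsValue-branch ((c , w , r) ∷ ts) y = begin
        termsValue (applyUpTo (λ a → c , a ◂ w , r) q ++ branch ts) y
      ≡⟨ termsValue-++ (applyUpTo (λ a → c , a ◂ w , r) q) (branch ts) y ⟩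
        termsValue (applyUpTo (λ a → c , a ◂ w , r) q) y + termsValue (branch ts) y
      ≡⟨ cong₂ _+_ (trans (termsValue-applyUpTo q (λ a → c , a ◂ w , r) y)
                          (trans (*-distribˡ-σ q c (λ a → residueStep (a ◂ w) r y))
                                 (cong (c *_) (σ-residueStep-◂ w r y))))
                   (termsValue-branch ts y) ⟩
        c * (if y zero then + 0 else + q * residueStep w r (y ∘ suc)) +
        (if y zero then + 0 else + q * termsValue ts (y ∘ suc))
      ≡⟨ collect (y zero) ⟩
        (if y zero then + 0 else + q * termsValue ((c , w , r) ∷ ts) (y ∘ suc))
      ∎
      where
      open ≡-Reasoning
      collect : ∀ b → c * (if b then + 0 else + q * residueStep w r (y ∘ suc)) +
                      (if b then + 0 else + q * termsValue ts (y ∘ suc))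
                    ≡ (if b then + 0 else + q * (c * residueStep w r (y ∘ suc) + termsValue ts (y ∘ suc)))
      collect true = cong (_+ + 0) (ℤ.*-zeroʳ c)
      collect false = distrib c (+ q) (residueStep w r (y ∘ suc)) (termsValue ts (y ∘ suc))
        where
        distrib : ∀ c q d e → c * (q * d) + q * e ≡ q * (c * d + e)
        distrib = solve-∀

    representation : (N b : ℕ) → (ℕ → ℤ) → List (Term N)
    representation zero zero g = []
    representation zero (suc b) g = (+ (q ℕ.^ suc b) * g 0 , (λ ()) , 0) ∷ []
    representation (suc N) zero g = []
    representation (suc N) (suc b) g = pad (representation N (suc b) g) ++ branch (representation N b (Δ g))

    defect : ∀ N b → (ℕ → ℤ) → (Fin N → Bool) → ℤ
    defect N b g y = termsValue (representation N b g) y - + (q ℕ.^ b) * g (zeros y)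

    -- Reading one more input y₀ shifts the number of zeros by [y₀ = 0], and g (s + 1) = g s + Δ g s.
    defect-suc : ∀ N b g y → defect (suc N) (suc b) g y ≡
      defect N (suc b) g (y ∘ suc) + (if y zero then + 0 else + q * defect N b (Δ g) (y ∘ suc))
    defect-suc N b g y =
      trans (cong (_- + (q ℕ.^ suc b) * g (zeros y))
                  (trans (termsValue-++ (pad A) (branch B) y) (cong₂ _+_ (termsValue-pad A y) (termsValue-branch B y))))
            (split (y zero))
      where
      A = representation N (suc b) g
      B = representation N b (Δ g)
      y′ = y ∘ suc
      s′ = zeros y′
      split : ∀ b₀ → termsValue A y′ + (if b₀ then + 0 else + q * termsValue B y′)
                       - + (q ℕ.^ suc b) * g ((if b₀ then 0 else 1) ℕ.+ s′)
                     ≡ defect N (suc b) g y′ + (if b₀ then + 0 else + q * defect N b (Δ g) y′)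
      split true = solve′ (termsValue A y′) (+ (q ℕ.^ suc b) * g s′)
        where
        solve′ : ∀ a c → a + + 0 - c ≡ a - c + + 0
        solve′ = solve-∀
      split false = begin
          termsValue A y′ + + q * termsValue B y′ - + (q ℕ.* q ℕ.^ b) * g (suc s′)
        ≡⟨ cong (λ z → termsValue A y′ + + q * termsValue B y′ - z * g (suc s′)) (ℤ.pos-* q (q ℕ.^ b)) ⟩
          termsValue A y′ + + q * termsValue B y′ - + q * + (q ℕ.^ b) * g (suc s′)
        ≡⟨ regroup (termsValue A y′) (termsValue B y′) (+ q) (+ (q ℕ.^ b)) (g s′) (g (suc s′)) ⟩
          termsValue A y′ - + q * + (q ℕ.^ b) * g s′ + + q * (termsValue B y′ - + (q ℕ.^ b) * Δ g s′)
        ≡⟨ cong (λ z → termsValue A y′ - z * g s′ + + q * defect N b (Δ g) y′) (sym (ℤ.pos-* q (q ℕ.^ b))) ⟩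
          defect N (suc b) g y′ + + q * defect N b (Δ g) y′
        ∎
        where
        open ≡-Reasoning
        regroup : ∀ a e Q Qᵇ G G′ → a + Q * e - Q * Qᵇ * G′ ≡ a - Q * Qᵇ * G + Q * (e - Qᵇ * (G′ - G))
        regroup = solve-∀

    ∣-defect₀ : ∀ {p x} → + p ∣ x → + p ∣ + 0 - + 1 * x
    ∣-defect₀ {p} {x} p∣x = subst (+ p ∣_) (sym (negate x)) (∣m⇒∣-m p∣x)
      where
      negate : ∀ x → + 0 - + 1 * x ≡ - x
      negate = solve-∀

    module _ (2≤q : 2 ≤ q) where

      residueStep-empty : ∀ y → residueStep {0} (λ ()) 0 y ≡ + 1
      residueStep-empty y = cong₂ (λ a b → χ ⌊ a ℕ.≟ a ⌋ - χ ⌊ a ℕ.≟ b ⌋) 0%q 1%q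
        where
        0%q : 0 % q ≡ 0
        0%q = m<n⇒m%n≡m (ℕ.<-trans (s≤s z≤n) 2≤q)
        1%q : 1 % q ≡ 1
        1%q = m<n⇒m%n≡m 2≤q

      representation-sound : ∀ {p} N b g → (∀ s → + p ∣ Δ^ b g s) → ∀ y → + p ∣ defect N b g y
      representation-sound zero zero g p∣g y = ∣-defect₀ (p∣g 0)
      representation-sound {p} zero (suc b) g _ y =
        subst (+ p ∣_) (sym (trans (cong (λ d → c * d + + 0 - c) (residueStep-empty y)) (cancel c))) (divides (+ 0) refl)
        where
        c = + (q ℕ.^ suc b) * g 0
        cancel : ∀ a → a * + 1 + + 0 - a ≡ + 0
        cancel = solve-∀
      representation-sound (suc N) zero g p∣g y = ∣-defect₀ (p∣g (zeros y))
      representation-sound {p} (suc N) (suc b) g p∣Δ^ y =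
        subst (+ p ∣_) (sym (defect-suc N b g y)) (combine (y zero))
        where
        combine : ∀ b₀ → + p ∣ defect N (suc b) g (y ∘ suc) + (if b₀ then + 0 else + q * defect N b (Δ g) (y ∘ suc))
        combine true = subst (+ p ∣_) (sym (ℤ.+-identityʳ _)) (representation-sound N (suc b) g p∣Δ^ (y ∘ suc))
        combine false = ∣m∣n⇒∣m+n (representation-sound N (suc b) g p∣Δ^ (y ∘ suc))
                                  (∣n⇒∣m*n (+ q) (representation-sound N b (Δ g) p∣Δ^ (y ∘ suc)))

    length-branch : ∀ {N} (ts : List (Term N)) → length (branch ts) ≡ q ℕ.* length ts
    length-branch [] = sym (ℕ.*-zeroʳ q)
    length-branch ((c , w , r) ∷ ts) = begin
      length (applyUpTo (λ a → c , a ◂ w , r) q ++ branch ts)  ≡⟨ List.length-++ (applyUpTo (λ a → c , a ◂ w , r) q) ⟩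
      length (applyUpTo (λ a → c , a ◂ w , r) q) ℕ.+ length (branch ts)
        ≡⟨ cong₂ ℕ._+_ (List.length-applyUpTo (λ a → c , a ◂ w , r) q) (length-branch ts) ⟩
      q ℕ.+ q ℕ.* length ts                                   ≡⟨ sym (ℕ.*-suc q (length ts)) ⟩
      q ℕ.* suc (length ts)                                   ∎
      where open ≡-Reasoning

    length-representation : ∀ N b g → length (representation N b g) ≤ (q ℕ.* suc N) ℕ.^ b
    length-representation zero zero g = z≤n
    length-representation zero (suc b) g = ℕ.m^n>0 (q ℕ.* 1) {{ℕ.m*n≢0 q 1}} (suc b)
    length-representation (suc N) zero g = z≤n
    length-representation (suc N) (suc b) g = begin
        length (pad A ++ branch B)
      ≡⟨ List.length-++ (pad A) ⟩
        length (pad A) ℕ.+ length (branch B)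
      ≡⟨ cong₂ ℕ._+_ (List.length-map _ A) (length-branch B) ⟩
        length A ℕ.+ q ℕ.* length B
      ≤⟨ ℕ.+-mono-≤ (length-representation N (suc b) g) (ℕ.*-monoʳ-≤ q (length-representation N b (Δ g))) ⟩
        X ℕ.* X ℕ.^ b ℕ.+ q ℕ.* X ℕ.^ b
      ≡⟨ sym (ℕ.*-distribʳ-+ (X ℕ.^ b) X q) ⟩
        (X ℕ.+ q) ℕ.* X ℕ.^ b
      ≤⟨ ℕ.*-monoʳ-≤ (X ℕ.+ q) (ℕ.^-monoˡ-≤ b (ℕ.m≤m+n X q)) ⟩
        (X ℕ.+ q) ℕ.* (X ℕ.+ q) ℕ.^ b
      ≡⟨ cong (λ z → z ℕ.* z ℕ.^ b) (trans (ℕ.+-comm X q) (sym (ℕ.*-suc q (suc N)))) ⟩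
        (q ℕ.* suc (suc N)) ℕ.^ suc b
      ∎
      where
      open ℕ.≤-Reasoning
      A = representation N (suc b) g
      B = representation N b (Δ g)
      X = q ℕ.* suc N

  zeros≡0⇒ANDₙ : ∀ {N} (y : Fin N → Bool) → zeros y ≡ 0 → ANDₙ y ≡ true
  zeros≡0⇒ANDₙ {zero} y _ = refl
  zeros≡0⇒ANDₙ {suc N} y eq with y zero
  ... | true = zeros≡0⇒ANDₙ (y ∘ suc) eq

  ANDₙ⇒zeros≡0 : ∀ {N} (y : Fin N → Bool) → ANDₙ y ≡ true → zeros y ≡ 0
  ANDₙ⇒zeros≡0 {zero} y _ = refl
  ANDₙ⇒zeros≡0 {suc N} y eq with y zero
  ... | true = ANDₙ⇒zeros≡0 (y ∘ suc) eq

  zeros≤ : ∀ {N} (y : Fin N → Bool) → zeros y ≤ N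
  zeros≤ {zero} y = z≤n
  zeros≤ {suc N} y with y zero
  ... | true = ℕ.m≤n⇒m≤1+n (zeros≤ (y ∘ suc))
  ... | false = s≤s (zeros≤ (y ∘ suc))

module PrimeProducts where

  open Binomials using (prime-power-∣-cancelʳ)
  open import Data.Nat
  open import Data.Nat.Properties
  open import Data.Nat.ListAction using (product)
  open import Data.Nat.Divisibility
  open import Data.Nat.Primality using (Prime; euclidsLemma; prime⇒nonZero; prime⇒irreducible; prime⇒nonTrivial)
  open import Data.Nat.Tactic.RingSolver using (solve-∀)
  open import Data.List using (List; []; _∷_; map)
  import Data.List.Properties as List
  open import Data.List.Relation.Unary.All as All using (All; []; _∷_)
  open import Data.List.Relation.Unary.AllPairs using ([]; _∷_)
  open import Data.List.Relation.Unary.Unique.Propositional using (Unique)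
  open import Data.Empty using (⊥-elim)
  open import Data.Sum using (inj₁; inj₂)
  open import Relation.Binary.PropositionalEquality
  open import Relation.Nullary using (¬_)

  1<prime : ∀ {p} → Prime p → 1 < p
  1<prime {p} pr = nonTrivial⇒n>1 p {{prime⇒nonTrivial pr}}

  private
    prime-∤-1 : ∀ {p} → Prime p → ¬ p ∣ 1
    prime-∤-1 pr p∣1 = nonTrivial⇒≢1 {{prime⇒nonTrivial pr}} (∣1⇒≡1 p∣1)

  prime-∤-product : ∀ {p} → Prime p → ∀ {as} → All (λ a → ¬ p ∣ a) as → ¬ p ∣ product as
  prime-∤-product pr [] = prime-∤-1 pr
  prime-∤-product pr {a ∷ as} (p∤a ∷ p∤as) p∣aas with euclidsLemma a (product as) pr p∣aas
  ... | inj₁ p∣a = p∤a p∣a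
  ... | inj₂ p∣as = prime-∤-product pr p∤as p∣as

  prime-∤-prime^ : ∀ {p q} → Prime p → Prime q → p ≢ q → ∀ e → ¬ p ∣ q ^ e
  prime-∤-prime^ pr qr p≢q zero = prime-∤-1 pr
  prime-∤-prime^ {p} {q} pr qr p≢q (suc e) p∣qqᵉ with euclidsLemma q (q ^ e) pr p∣qqᵉ
  ... | inj₂ p∣qᵉ = prime-∤-prime^ pr qr p≢q e p∣qᵉ
  ... | inj₁ p∣q with prime⇒irreducible qr p∣q
  ...   | inj₁ p≡1 = prime-∤-1 pr (∣-reflexive p≡1)
  ...   | inj₂ p≡q = p≢q p≡q

  powers : (ℕ → ℕ) → List ℕ → List ℕ
  powers e = map (λ p → p ^ e p)

  prime-∤-powers : ∀ {p} → Prime p → ∀ {qs} → All Prime qs → All (p ≢_) qs → ∀ e → ¬ p ∣ product (powers e qs)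
  prime-∤-powers pr {qs} primes fresh e = prime-∤-product pr (go primes fresh)
    where
    go : ∀ {qs} → All Prime qs → All (_ ≢_) qs → All (λ a → ¬ _ ∣ a) (powers e qs)
    go [] [] = []
    go {q ∷ _} (qr ∷ qrs) (p≢q ∷ p≢qs) = prime-∤-prime^ pr qr p≢q (e q) ∷ go qrs p≢qs

  product-powers-∣ : ∀ e {ps} s → Unique ps → All Prime ps → All (λ p → p ^ e p ∣ s) ps →
    product (powers e ps) ∣ s
  product-powers-∣ e s [] [] [] = 1∣ s
  product-powers-∣ e {p ∷ ps} s (fresh ∷ unique) (pr ∷ primes) (pᵉ∣s ∷ rest)
    with product-powers-∣ e s unique primes rest
  ... | divides k refl = *-monoˡ-∣ Q
    (prime-power-∣-cancelʳ pr (prime-∤-powers pr primes fresh e) (e p) k pᵉ∣s)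
    where Q = product (powers e ps)

  powers-1 : ∀ ps → powers (λ _ → 1) ps ≡ ps
  powers-1 ps = List.map-id-local (All.tabulate (λ {p} _ → *-identityʳ p))

  product-∣ : ∀ {ps} s → Unique ps → All Prime ps → All (_∣ s) ps → product ps ∣ s
  product-∣ {ps} s unique primes ∣s =
    subst (λ qs → product qs ∣ s) (powers-1 ps)
      (product-powers-∣ (λ _ → 1) s unique primes (All.map (∣-trans (∣-reflexive (*-identityʳ _))) ∣s))

  -- combination X ps = ∑ₚ (∏ ps / p) · X p
  combination : (ℕ → ℕ) → List ℕ → ℕ
  combination X [] = 0
  combination X (p ∷ ps) = product ps * X p + p * combination X ps

  product-∣-combination : ∀ X ps → All (λ p → p ∣ X p) ps → product ps ∣ combination X ps
  product-∣-combination X [] [] = 1∣ 0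
  product-∣-combination X (p ∷ ps) (divides k eq ∷ rest) = ∣m∣n⇒∣m+n
    (divides k (trans (cong (product ps *_) eq) (rearrange (product ps) k p)))
    (*-monoʳ-∣ p (product-∣-combination X ps rest))
    where
    rearrange : ∀ a k p → a * (k * p) ≡ k * (p * a)
    rearrange = solve-∀

  combination-∣-product : ∀ X {ps} → Unique ps → All Prime ps → product ps ∣ combination X ps →
    All (λ p → p ∣ X p) ps
  combination-∣-product X [] [] _ = []
  combination-∣-product X {p ∷ ps} (fresh ∷ unique) (pr ∷ primes) ∣comb =
    p∣Xp ∷ combination-∣-product X unique primes ∣rest
    where
    instance _ = prime⇒nonZero pr
    Q = product ps
    p∤Q : ¬ p ∣ Q
    p∤Q p∣Q = prime-∤-powers pr primes fresh (λ _ → 1) (subst (p ∣_) (cong product (sym (powers-1 ps))) p∣Q)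
    p∣QXp : p ∣ Q * X p
    p∣QXp = ∣m+n∣m⇒∣n (subst (p ∣_) (+-comm (Q * X p) _) (∣-trans (m∣m*n Q) ∣comb)) (m∣m*n (combination X ps))
    p∣Xp : p ∣ X p
    p∣Xp with euclidsLemma Q (X p) pr p∣QXp
    ... | inj₁ p∣Q = ⊥-elim (p∤Q p∣Q)
    ... | inj₂ p∣Xp = p∣Xp
    ∣rest : Q ∣ combination X ps
    ∣rest with p∣Xp
    ... | divides k eq = ∣m+n∣m⇒∣n (*-cancelˡ-∣ p (subst (p * Q ∣_) factor ∣comb)) (m∣m*n k)
      where
      factor : Q * X p + p * combination X ps ≡ p * (Q * k + combination X ps)
      factor = trans (cong (λ z → Q * z + p * combination X ps) eq) (distrib Q k p (combination X ps))
        where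
        distrib : ∀ a k p s → a * (k * p) + p * s ≡ p * (a * k + s)
        distrib = solve-∀

module Estimates where

  open import Data.Nat
  open import Data.Nat.Properties
  open import Data.Nat.Tactic.RingSolver using (solve-∀)
  open import Data.Nat.Logarithm using (⌈log₂_⌉)
  open import Data.Nat.Logarithm.Core using (⌈log2⌉)
  open import Data.Nat.Induction using (<-wellFounded)
  open import Induction.WellFounded using (Acc; acc)
  open import Data.Bool using (if_then_else_)
  open import Data.Product using (∃; _×_; _,_)
  open import Relation.Binary.PropositionalEquality
  open import Relation.Nullary using (yes; no)
  open import Relation.Nullary.Decidable using (⌊_⌋)

  open ≤-Reasoning

  ^-distribʳ-* : ∀ a b n → (a * b) ^ n ≡ a ^ n * b ^ n
  ^-distribʳ-* a b zero = refl
  ^-distribʳ-* a b (suc n) = trans (cong (a * b *_) (^-distribʳ-* a b n)) (interchange a b (a ^ n) (b ^ n))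
    where
    interchange : ∀ a b x y → a * b * (x * y) ≡ a * x * (b * y)
    interchange = solve-∀

  1≤^ : ∀ a n → 1 ≤ a → 1 ≤ a ^ n
  1≤^ (suc a) n _ = m^n>0 (suc a) n

  n<2^n : ∀ n → n < 2 ^ n
  n<2^n zero = s≤s z≤n
  n<2^n (suc n) = begin-strict
    suc n          <⟨ s≤s (n<2^n n) ⟩
    suc (2 ^ n)    ≤⟨ +-monoˡ-≤ (2 ^ n) (1≤^ 2 n (s≤s z≤n)) ⟩
    2 ^ n + 2 ^ n  ≡⟨ cong (2 ^ n +_) (sym (+-identityʳ (2 ^ n))) ⟩
    2 ^ suc n      ∎

  n≤2^⌈log₂n⌉ : ∀ n → n ≤ 2 ^ ⌈log₂ n ⌉
  n≤2^⌈log₂n⌉ n = go n (<-wellFounded n)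
    where
    go : ∀ n (rec : Acc _<_ n) → n ≤ 2 ^ ⌈log2⌉ n rec
    go zero _ = z≤n
    go (suc zero) _ = s≤s z≤n
    go (suc (suc n)) (acc rs) = begin
        suc (suc n)
      ≤⟨ s≤s (s≤s (≤-trans (≤-reflexive (sym (⌊n/2⌋+⌈n/2⌉≡n n))) (+-monoˡ-≤ ⌈ n /2⌉ (⌊n/2⌋≤⌈n/2⌉ n)))) ⟩
        suc (suc (⌈ n /2⌉ + ⌈ n /2⌉))
      ≡⟨ cong suc (sym (+-suc ⌈ n /2⌉ ⌈ n /2⌉)) ⟩
        suc ⌈ n /2⌉ + suc ⌈ n /2⌉
      ≤⟨ +-mono-≤ half (≤-trans half (≤-reflexive (sym (+-identityʳ _)))) ⟩
        2 ^ suc (⌈log2⌉ (suc ⌈ n /2⌉) (rs (⌈n/2⌉<n n)))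
      ∎
      where half = go (suc ⌈ n /2⌉) (rs (⌈n/2⌉<n n))

  1≤base : ∀ k .{{_ : NonZero k}} {a R} → a < R ^ k → 1 ≤ R
  1≤base k {R = suc _} _ = s≤s z≤n
  1≤base (suc k) {R = zero} ()

  integer-root : ∀ k .{{_ : NonZero k}} a → ∃ λ R → a < R ^ k × R ^ k ≤ 2 ^ k * suc a
  integer-root k zero =
    1 , ≤-reflexive (sym (^-zeroˡ k)) ,
    ≤-trans (≤-reflexive (^-zeroˡ k)) (≤-trans (1≤^ 2 k (s≤s z≤n)) (≤-reflexive (sym (*-identityʳ (2 ^ k)))))
  integer-root k (suc a) with integer-root k a
  ... | R , a<Rᵏ , Rᵏ≤ with suc a <? R ^ k
  ...   | yes 1+a<Rᵏ = R , 1+a<Rᵏ , ≤-trans Rᵏ≤ (*-monoʳ-≤ (2 ^ k) (n≤1+n (suc a)))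
  ...   | no 1+a≮Rᵏ = suc R , 1+a<[1+R]ᵏ , [1+R]ᵏ≤
    where
    Rᵏ≡1+a : R ^ k ≡ suc a
    Rᵏ≡1+a = ≤-antisym (≮⇒≥ 1+a≮Rᵏ) a<Rᵏ
    1≤R : 1 ≤ R
    1≤R = 1≤base k a<Rᵏ
    1+a<[1+R]ᵏ : suc a < suc R ^ k
    1+a<[1+R]ᵏ = <-≤-trans (≤-reflexive (cong suc (sym Rᵏ≡1+a))) (^-monoˡ-< k (n<1+n R))
    [1+R]ᵏ≤ : suc R ^ k ≤ 2 ^ k * suc (suc a)
    [1+R]ᵏ≤ = begin
      suc R ^ k          ≤⟨ ^-monoˡ-≤ k (≤-trans (+-monoˡ-≤ R 1≤R) (≤-reflexive (cong (R +_) (sym (+-identityʳ R))))) ⟩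
      (2 * R) ^ k        ≡⟨ ^-distribʳ-* 2 R k ⟩
      2 ^ k * R ^ k      ≡⟨ cong (2 ^ k *_) Rᵏ≡1+a ⟩
      2 ^ k * suc a      ≤⟨ *-monoʳ-≤ (2 ^ k) (n≤1+n (suc a)) ⟩
      2 ^ k * suc (suc a) ∎

  ceilLog : ℕ → ℕ → ℕ
  ceilLog p zero = 0
  ceilLog p (suc R) = if ⌊ suc R ≤? p ^ ceilLog p R ⌋ then ceilLog p R else suc (ceilLog p R)

  ceilLog-bounds : ∀ p → 2 ≤ p → ∀ R → R ≤ p ^ ceilLog p R × p ^ ceilLog p R ≤ p * R + 1
  ceilLog-bounds p 2≤p zero = z≤n , ≤-reflexive (sym (cong (_+ 1) (*-zeroʳ p)))
  ceilLog-bounds p 2≤p (suc R) with ceilLog-bounds p 2≤p R | suc R ≤? p ^ ceilLog p R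
  ... | lower , upper | yes 1+R≤pᵉ = 1+R≤pᵉ , ≤-trans upper (+-monoˡ-≤ 1 (*-monoʳ-≤ p (n≤1+n R)))
  ... | lower , upper | no 1+R≰pᵉ = lower′ , upper′
    where
    pᵉ≡R : p ^ ceilLog p R ≡ R
    pᵉ≡R = ≤-antisym (≤-pred (≰⇒> 1+R≰pᵉ)) lower
    instance _ = >-nonZero (<-trans (s≤s z≤n) 2≤p)
    1≤R : 1 ≤ R
    1≤R = subst (1 ≤_) pᵉ≡R (m^n>0 p (ceilLog p R))
    lower′ : suc R ≤ p * p ^ ceilLog p R
    lower′ = subst (λ z → suc R ≤ p * z) (sym pᵉ≡R)
      (≤-trans (+-monoˡ-≤ R 1≤R) (≤-trans (≤-reflexive (cong (R +_) (sym (+-identityʳ R)))) (*-monoˡ-≤ R 2≤p)))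
    upper′ : p * p ^ ceilLog p R ≤ p * suc R + 1
    upper′ = subst (λ z → p * z ≤ p * suc R + 1) (sym pᵉ≡R) (≤-trans (*-monoʳ-≤ p (n≤1+n R)) (m≤m+n _ 1))

  ≤-*ʳ : ∀ a {b} → 1 ≤ b → a ≤ a * b
  ≤-*ʳ a 1≤b = ≤-trans (≤-reflexive (sym (*-identityʳ a))) (*-monoʳ-≤ a 1≤b)

  2^-+ : ∀ a b → 2 ^ a * 2 ^ b ≡ 2 ^ (a + b)
  2^-+ a b = sym (^-distribˡ-+-* 2 a b)

  -- Number of arguments of the top gate of an AND gadget of fan-in N: two per term, at most
  -- (m (N + 1))^(mR + 1) terms for each of the r prime divisors of m.
  argBound : (m N R r : ℕ) → ℕ
  argBound m N R r = r * (2 * (m * suc N) ^ (m * R + 1))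

  branching : (m N R r : ℕ) → ℕ
  branching m N R r = 2 * argBound m N R r * suc N

  slope : (m K r : ℕ) → ℕ
  slope m K r = (m + K + 2) * (m + 2) + r + 2

  sizeConstant : (m K r : ℕ) → ℕ
  sizeConstant m K r = (slope m K r * K) ^ (r * K) * (2 ^ ((r + 1) * K) * 2 ^ K)

  module SizeBound (m K r n L N R : ℕ) (1≤K : 1 ≤ K) (1≤L : 1 ≤ L) (1≤N : 1 ≤ N) (1≤R : 1 ≤ R)
                   (n≤2ᴸ : n ≤ 2 ^ L) (Nᴷ≤ : N ^ K ≤ 2 ^ K * n) (Rʳ≤ : R ^ r ≤ 2 ^ r * suc N) where

    c₁ = slope m K r
    W = branching m N R r

    -- With N ≈ n^(1/K) and R ≈ N^(1/r) this is O(n^(1/(rK)) log n).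
    exponent : ℕ
    exponent = c₁ * R * L * K

    private
      a = m + (1 + K + L)

      1+N≤ : suc N ≤ 2 ^ (1 + K + L)
      1+N≤ = begin
          suc N
        ≤⟨ +-monoˡ-≤ N 1≤N ⟩
          N + N
        ≤⟨ +-mono-≤ N≤ (≤-trans N≤ (≤-reflexive (sym (+-identityʳ _)))) ⟩
          2 ^ (1 + K + L)
        ∎
        where
        N≤ : N ≤ 2 ^ (K + L)
        N≤ = begin
          N              ≤⟨ ≤-trans (≤-reflexive (sym (^-identityʳ N))) (^-monoʳ-≤ N {{>-nonZero 1≤N}} 1≤K) ⟩
          N ^ K          ≤⟨ Nᴷ≤ ⟩
          2 ^ K * n      ≤⟨ *-monoʳ-≤ (2 ^ K) n≤2ᴸ ⟩
          2 ^ K * 2 ^ L  ≡⟨ 2^-+ K L ⟩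
          2 ^ (K + L)    ∎

      m[1+N]≤ : m * suc N ≤ 2 ^ a
      m[1+N]≤ = ≤-trans (*-mono-≤ (<⇒≤ (n<2^n m)) 1+N≤) (≤-reflexive (2^-+ m (1 + K + L)))

      E₀ = 1 + (r + (1 + a * (m * R + 1))) + a

      W≤ : W ≤ 2 ^ E₀
      W≤ = begin
          2 * (r * (2 * (m * suc N) ^ (m * R + 1))) * suc N
        ≤⟨ *-mono-≤ (*-monoʳ-≤ 2 (*-mono-≤ (<⇒≤ (n<2^n r)) (*-monoʳ-≤ 2 (^-monoˡ-≤ (m * R + 1) m[1+N]≤))))
                    (≤-trans 1+N≤ (^-monoʳ-≤ 2 (m≤n+m (1 + K + L) m))) ⟩
          2 * (2 ^ r * (2 * (2 ^ a) ^ (m * R + 1))) * 2 ^ a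
        ≡⟨ cong (λ z → 2 * (2 ^ r * (2 * z)) * 2 ^ a) (^-*-assoc 2 a (m * R + 1)) ⟩
          2 * (2 ^ r * (2 * 2 ^ (a * (m * R + 1)))) * 2 ^ a
        ≡⟨ cong (λ z → 2 * (2 ^ r * z) * 2 ^ a) (2^-+ 1 (a * (m * R + 1))) ⟩
          2 * (2 ^ r * 2 ^ (1 + a * (m * R + 1))) * 2 ^ a
        ≡⟨ cong (λ z → 2 * z * 2 ^ a) (2^-+ r (1 + a * (m * R + 1))) ⟩
          2 * 2 ^ (r + (1 + a * (m * R + 1))) * 2 ^ a
        ≡⟨ cong (_* 2 ^ a) (2^-+ 1 (r + (1 + a * (m * R + 1)))) ⟩
          2 ^ (1 + (r + (1 + a * (m * R + 1)))) * 2 ^ a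
        ≡⟨ 2^-+ (1 + (r + (1 + a * (m * R + 1)))) a ⟩
          2 ^ E₀
        ∎

      E₀≤ : E₀ ≤ c₁ * R * L
      E₀≤ = begin
          E₀
        ≡⟨ regroup r a m R ⟩
          (r + 2) + a * (m * R + 2)
        ≤⟨ +-mono-≤ (≤-*ʳ (r + 2) (*-mono-≤ 1≤R 1≤L)) (*-mono-≤ a≤ mR+2≤) ⟩
          (r + 2) * (R * L) + (m + K + 2) * L * ((m + 2) * R)
        ≡⟨ collect r m K R L ⟩
          c₁ * R * L
        ∎
        where
        regroup : ∀ r a m R → 1 + (r + (1 + a * (m * R + 1))) + a ≡ (r + 2) + a * (m * R + 2)
        regroup = solve-∀
        collect : ∀ r m K R L → (r + 2) * (R * L) + (m + K + 2) * L * ((m + 2) * R) ≡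
                                ((m + K + 2) * (m + 2) + r + 2) * R * L
        collect = solve-∀
        a≤ : a ≤ (m + K + 2) * L
        a≤ = begin
            m + (1 + K + L)         ≡⟨ solve₁ m K L ⟩
            (m + K + 1) + L         ≤⟨ +-monoˡ-≤ L (≤-*ʳ (m + K + 1) 1≤L) ⟩
            (m + K + 1) * L + L     ≡⟨ solve₂ m K L ⟩
            (m + K + 2) * L         ∎
          where
          solve₁ : ∀ m K L → m + (1 + K + L) ≡ (m + K + 1) + L
          solve₁ = solve-∀
          solve₂ : ∀ m K L → (m + K + 1) * L + L ≡ (m + K + 2) * L
          solve₂ = solve-∀
        mR+2≤ : m * R + 2 ≤ (m + 2) * R
        mR+2≤ = ≤-trans (+-monoʳ-≤ (m * R) (≤-*ʳ 2 1≤R)) (≤-reflexive (solve₃ m R))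
          where
          solve₃ : ∀ m R → m * R + 2 * R ≡ (m + 2) * R
          solve₃ = solve-∀

    Wᴷ≤2^exponent : W ^ K ≤ 2 ^ exponent
    Wᴷ≤2^exponent = begin
      W ^ K                ≤⟨ ^-monoˡ-≤ K (≤-trans W≤ (^-monoʳ-≤ 2 E₀≤)) ⟩
      (2 ^ (c₁ * R * L)) ^ K ≡⟨ ^-*-assoc 2 (c₁ * R * L) K ⟩
      2 ^ exponent         ∎

    exponent-bound : exponent ^ (r * K) ≤ sizeConstant m K r * n * L ^ (r * K)
    exponent-bound = begin
        exponent ^ d
      ≡⟨ cong (_^ d) (rearrange c₁ R L K) ⟩
        ((c₁ * K) * R * L) ^ d
      ≡⟨ ^-distribʳ-* ((c₁ * K) * R) L d ⟩
        ((c₁ * K) * R) ^ d * L ^ d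
      ≡⟨ cong (_* L ^ d) (^-distribʳ-* (c₁ * K) R d) ⟩
        (c₁ * K) ^ d * R ^ d * L ^ d
      ≤⟨ *-monoˡ-≤ (L ^ d) (*-monoʳ-≤ ((c₁ * K) ^ d) Rᵈ≤) ⟩
        (c₁ * K) ^ d * (2 ^ ((r + 1) * K) * 2 ^ K * n) * L ^ d
      ≡⟨ reassoc ((c₁ * K) ^ d) (2 ^ ((r + 1) * K)) (2 ^ K) n (L ^ d) ⟩
        sizeConstant m K r * n * L ^ d
      ∎
      where
      d = r * K
      rearrange : ∀ c R L K → c * R * L * K ≡ (c * K) * R * L
      rearrange = solve-∀
      reassoc : ∀ A B D n Y → A * (B * D * n) * Y ≡ A * (B * D) * n * Y
      reassoc = solve-∀
      1+N≤2N : suc N ≤ 2 * N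
      1+N≤2N = ≤-trans (+-monoˡ-≤ N 1≤N) (≤-reflexive (cong (N +_) (sym (+-identityʳ N))))
      Rᵈ≤ : R ^ d ≤ 2 ^ ((r + 1) * K) * 2 ^ K * n
      Rᵈ≤ = begin
          R ^ (r * K)
        ≡⟨ sym (^-*-assoc R r K) ⟩
          (R ^ r) ^ K
        ≤⟨ ^-monoˡ-≤ K (≤-trans Rʳ≤ (*-monoʳ-≤ (2 ^ r) 1+N≤2N)) ⟩
          (2 ^ r * (2 * N)) ^ K
        ≡⟨ cong (_^ K) (trans (sym (*-assoc (2 ^ r) 2 N)) (cong (_* N) (*-comm (2 ^ r) 2))) ⟩
          (2 ^ (1 + r) * N) ^ K
        ≡⟨ ^-distribʳ-* (2 ^ (1 + r)) N K ⟩
          (2 ^ (1 + r)) ^ K * N ^ K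
        ≡⟨ cong (_* N ^ K) (trans (^-*-assoc 2 (1 + r) K) (cong (λ z → 2 ^ (z * K)) (+-comm 1 r))) ⟩
          2 ^ ((r + 1) * K) * N ^ K
        ≤⟨ *-monoʳ-≤ (2 ^ ((r + 1) * K)) Nᴷ≤ ⟩
          2 ^ ((r + 1) * K) * (2 ^ K * n)
        ≡⟨ sym (*-assoc (2 ^ ((r + 1) * K)) (2 ^ K) n) ⟩
          2 ^ ((r + 1) * K) * 2 ^ K * n
        ∎

module AndGates where

  open import Defs
  open Compilation
  open FiniteDifferences using (prime-∣-Δ^-periodic)
  open ResidueRepresentation
  open PrimeProducts
  open Estimates using (ceilLog; ceilLog-bounds; argBound)
  open import Data.Nat as ℕ using (ℕ; zero; suc; _+_; _*_; _^_; _≤_; _<_; z≤n; s≤s; NonZero)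
  import Data.Nat.Properties as ℕ
  open import Data.Nat.DivMod using (_%_; _mod_; m%n<n; m%n*o≡m*o%[n*o]; %-congʳ; %-congˡ)
  open import Data.Nat.Divisibility as ℕ∣ using (_∣_; _∣?_)
  open import Data.Nat.ListAction using (product)
  open import Data.Nat.Primality using (Prime; prime⇒nonZero)
  open import Data.Nat.Tactic.RingSolver as ℕ-Solver using ()
  import Algebra.Properties.Semiring.Sum ℕ.+-*-semiring as Sum
  open import Data.Integer as ℤ using (ℤ; +_; -_; _-_) renaming (_+_ to _+ℤ_; _*_ to _*ℤ_)
  import Data.Integer.Properties as ℤ
  import Data.Integer.DivMod as ℤ
  open import Data.Integer.Divisibility.Signed as ℤ∣ using () renaming (_∣_ to _∣ℤ_)
  open import Data.Integer.Tactic.RingSolver as ℤ-Solver using ()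
  open import Data.Bool using (Bool; true; false; if_then_else_)
  open import Data.Fin using (Fin; zero; suc; toℕ)
  import Data.Fin.Properties as Fin
  open import Data.Fin.Subset using (Subset)
  open import Data.Vec using (lookup; tabulate)
  import Data.Vec.Properties as Vec
  open import Data.List as List using (List; []; _∷_; _++_; length)
  import Data.List.Properties as List
  open import Data.List.Relation.Unary.All as All using (All; []; _∷_)
  import Data.List.Relation.Unary.All.Properties as All
  open import Data.List.Relation.Unary.Unique.Propositional using (Unique)
  open import Data.Product using (_×_; _,_; proj₁; proj₂)
  open import Data.Empty using (⊥-elim)
  open import Function using (_∘_)
  open import Relation.Binary.PropositionalEquality
  open import Relation.Nullary using (¬_; yes; no)
  open import Relation.Nullary.Decidable using (⌊_⌋)

  record DistinctPrimeDivisors (m : ℕ) (ps : List ℕ) : Set where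
    field
      unique        : Unique ps
      allPrime      : All Prime ps
      allDivide     : All (_∣ m) ps
      partner       : ℕ → ℕ
      partner-prime : ∀ p → Prime (partner p)
      partner-∣     : ∀ p → partner p ∣ m
      partner-≢     : ∀ p → partner p ≢ p

  module ResidueGates (m : ℕ) .{{_ : NonZero m}} (n : ℕ) where

    open FormulaCompilation m n

    acceptIf : (ℕ → Bool) → Subset m
    acceptIf f = tabulate (f ∘ toℕ)

    lookup-acceptIf : ∀ f s → lookup (acceptIf f) (s mod m) ≡ f (s % m)
    lookup-acceptIf f s = trans (Vec.lookup∘tabulate (f ∘ toℕ) (s mod m)) (cong f (Fin.toℕ-fromℕ< (m%n<n s m)))

    children : ∀ {N} → (Fin N → ℕ) → (Fin N → Formula) → Args
    children w ch = List.tabulate (λ i → w i , ch i)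

    argSum-children : ∀ {N} (w : Fin N → ℕ) ch x →
      argSum (children w ch) x ≡ ∑ (λ i → if eval (ch i) x then w i else 0)
    argSum-children {zero} w ch x = refl
    argSum-children {suc N} w ch x = cong (_+_ (if eval (ch zero) x then w zero else 0)) (argSum-children (w ∘ suc) (ch ∘ suc) x)

    argsGateCount-children : ∀ {N} (w : Fin N → ℕ) ch → argsGateCount (children w ch) ≡ ∑ (λ i → gateCount (ch i))
    argsGateCount-children {zero} w ch = refl
    argsGateCount-children {suc N} w ch = cong (_+_ (gateCount (ch zero))) (argsGateCount-children (w ∘ suc) (ch ∘ suc))

    -- Scaling every weight by k = m/q turns a MOD_m gate into a test of the weighted sum modulo q.
    residueGate : ∀ {N} → (Fin N → Formula) → (k : ℕ) → (Fin N → ℕ) → ℕ → Formula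
    residueGate ch k w t = gate (acceptIf (λ a → ⌊ a ℕ.≟ t ⌋)) (children (λ i → w i * k) ch)

    eval-residueGate : ∀ {N} (ch : Fin N → Formula) q k .{{_ : NonZero q}} .{{_ : NonZero k}} → m ≡ q * k →
      ∀ w r x → eval (residueGate ch k w ((r % q) * k)) x ≡ Modulo.hits q w r (λ i → eval (ch i) x)
    eval-residueGate ch q k m≡qk w r x =
      trans (lookup-acceptIf (λ a → ⌊ a ℕ.≟ (r % q) * k ⌋) S)
            (≟-cong (λ eq → ℕ.*-cancelʳ-≡ _ _ k (trans (sym S%m≡) eq)) (λ eq → trans S%m≡ (cong (_* k) eq)))
      where
      W = Modulo.weight q w (λ i → eval (ch i) x)
      S = argSum (children (λ i → w i * k) ch) x
      S≡ : S ≡ W * k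
      S≡ = trans (argSum-children (λ i → w i * k) ch x)
                 (trans (Sum.sum-cong-≗ (λ i → if-* (eval (ch i) x) (w i)))
                        (sym (Sum.*-distribʳ-sum k (λ i → if eval (ch i) x then w i else 0))))
        where
        if-* : ∀ b a → (if b then a * k else 0) ≡ (if b then a else 0) * k
        if-* true a = refl
        if-* false a = refl
      S%m≡ : S % m ≡ (W % q) * k
      S%m≡ = trans (%-congʳ {o = S} m≡qk) (trans (%-congˡ {o = q * k} S≡) (sym (m%n*o≡m*o%[n*o] W q k)))
        where instance _ = ℕ.m*n≢0 q k
      ≟-cong : ∀ {a b c d} → (a ≡ b → c ≡ d) → (c ≡ d → a ≡ b) → ⌊ a ℕ.≟ b ⌋ ≡ ⌊ c ℕ.≟ d ⌋
      ≟-cong {a} {b} {c} {d} f g with a ℕ.≟ b | c ℕ.≟ d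
      ... | yes _ | yes _ = refl
      ... | no _ | no _ = refl
      ... | yes eq | no ne = ⊥-elim (ne (f eq))
      ... | no ne | yes eq = ⊥-elim (ne (g eq))

  -- A representative of c modulo p (junk for p = 0).
  _mod′_ : ℤ → ℕ → ℕ
  c mod′ zero = 0
  c mod′ suc p = c ℤ.%ℕ suc p

  mod′-≡ : ∀ c p → 1 ≤ p → + p ∣ℤ + (c mod′ p) - c
  mod′-≡ c (suc p) _ =
    subst (+ suc p ∣ℤ_) (rearrange (c ℤ.%ℕ suc p) (c ℤ./ℕ suc p) (+ suc p) c (ℤ.a≡a%ℕn+[a/ℕn]*n c (suc p)))
          (ℤ∣.divides (- (c ℤ./ℕ suc p)) refl)
    where
    rearrange : ∀ a b d c → c ≡ + a +ℤ b *ℤ d → - b *ℤ d ≡ + a - c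
    rearrange a b d c refl = solve (+ a) b d
      where
      solve : ∀ a b d → - b *ℤ d ≡ a - (a +ℤ b *ℤ d)
      solve = ℤ-Solver.solve-∀

  ∣-select : ∀ {p} (b₁ b₂ : Bool) (c : ℤ) {A B : ℕ} → + p ∣ℤ + A - c → + p ∣ℤ + B - (- c) →
    + p ∣ℤ + ((if b₁ then A else 0) + (if b₂ then B else 0)) - c *ℤ (χ b₁ - χ b₂)
  ∣-select true true c {A} {B} A≡c B≡-c = subst (_ ∣ℤ_) (sym (solve (+ A) (+ B) c)) (ℤ∣.∣m∣n⇒∣m+n A≡c B≡-c)
    where
    solve : ∀ a b c → a +ℤ b - c *ℤ (+ 1 - + 1) ≡ (a - c) +ℤ (b - (- c))
    solve = ℤ-Solver.solve-∀
  ∣-select true false c {A} A≡c _ = subst (_ ∣ℤ_) (sym (trans (cong (_- c *ℤ (+ 1 - + 0)) (ℤ.pos-+ A 0)) (solve (+ A) c))) A≡c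
    where
    solve : ∀ a c → a +ℤ + 0 - c *ℤ (+ 1 - + 0) ≡ a - c
    solve = ℤ-Solver.solve-∀
  ∣-select false true c {B = B} _ B≡-c = subst (_ ∣ℤ_) (sym (solve (+ B) c)) B≡-c
    where
    solve : ∀ b c → b - c *ℤ (+ 0 - + 1) ≡ b - (- c)
    solve = ℤ-Solver.solve-∀
  ∣-select false false c _ _ = subst (_ ∣ℤ_) (sym (solve c)) (ℤ∣.divides (+ 0) refl)
    where
    solve : ∀ c → + 0 - c *ℤ (+ 0 - + 0) ≡ + 0
    solve = ℤ-Solver.solve-∀

  module Gadget (m : ℕ) .{{_ : NonZero m}} (n : ℕ) {ps : List ℕ} (D : DistinctPrimeDivisors m ps) (N R : ℕ) where

    open DistinctPrimeDivisors D
    open FormulaCompilation m n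
    open ResidueGates m n

    instance
      partner-nonZero : ∀ {p} → NonZero (partner p)
      partner-nonZero {p} = prime⇒nonZero (partner-prime p)

    cofactor : ℕ → ℕ
    cofactor p = ℕ∣._∣_.quotient (partner-∣ p)

    m≡partner*cofactor : ∀ p → m ≡ partner p * cofactor p
    m≡partner*cofactor p = trans (ℕ∣._∣_.equality (partner-∣ p)) (ℕ.*-comm (cofactor p) (partner p))

    instance
      cofactor-nonZero : ∀ {p} → NonZero (cofactor p)
      cofactor-nonZero {p} = ℕ.≢-nonZero λ k≡0 →
        ℕ.≢-nonZero⁻¹ m (trans (m≡partner*cofactor p) (trans (cong (partner p *_) k≡0) (ℕ.*-zeroʳ (partner p))))

    period : ℕ → ℕ
    period p = p ^ ceilLog p R

    nonMultiple : ℕ → ℕ → ℤ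
    nonMultiple p s = if ⌊ period p ∣? s ⌋ then + 0 else + 1

    termsFor : (p : ℕ) → List (Modulo.Term (partner p) N)
    termsFor p = Modulo.representation (partner p) N (period p) (nonMultiple p)

    Term : Set
    Term = ℤ × (Fin N → ℕ) × ℕ

    hits : ℕ → (Fin N → ℕ) → ℕ → (Fin N → Bool) → Bool
    hits p = Modulo.hits (partner p)

    residueSum : ℕ → List Term → (Fin N → Bool) → ℕ
    residueSum p [] y = 0
    residueSum p ((c , w , r) ∷ ts) y =
      (if hits p w r y then c mod′ p else 0) + (if hits p w (suc r) y then (- c) mod′ p else 0) + residueSum p ts y

    residueSum-≡ : ∀ p → 1 ≤ p → ∀ ts y → + p ∣ℤ + residueSum p ts y - Modulo.termsValue (partner p) ts y
    residueSum-≡ p 1≤p [] y = ℤ∣.divides (+ 0) refl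
    residueSum-≡ p 1≤p ((c , w , r) ∷ ts) y =
      subst (_ ∣ℤ_) (sym (trans (cong (_- (t +ℤ Modulo.termsValue (partner p) ts y)) (ℤ.pos-+ A (residueSum p ts y)))
                               (regroup (+ A) (+ residueSum p ts y) t (Modulo.termsValue (partner p) ts y))))
        (ℤ∣.∣m∣n⇒∣m+n (∣-select (hits p w r y) (hits p w (suc r) y) c (mod′-≡ c p 1≤p) (mod′-≡ (- c) p 1≤p))
                      (residueSum-≡ p 1≤p ts y))
      where
      A = (if hits p w r y then c mod′ p else 0) + (if hits p w (suc r) y then (- c) mod′ p else 0)
      t = Modulo.termValue (partner p) (c , w , r) y
      regroup : ∀ a b e f → a +ℤ b - (e +ℤ f) ≡ (a - e) +ℤ (b - f)
      regroup = ℤ-Solver.solve-∀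

    termArgs : (Fin N → Formula) → ℕ → ℕ → List Term → Args
    termArgs ch p K [] = []
    termArgs ch p K ((c , w , r) ∷ ts) =
      (K * (c mod′ p) , residueGate ch (cofactor p) w ((r % partner p) * cofactor p)) ∷
      (K * ((- c) mod′ p) , residueGate ch (cofactor p) w ((suc r % partner p) * cofactor p)) ∷ termArgs ch p K ts

    argSum-termArgs : ∀ ch p K ts x → argSum (termArgs ch p K ts) x ≡ K * residueSum p ts (λ i → eval (ch i) x)
    argSum-termArgs ch p K [] x = sym (ℕ.*-zeroʳ K)
    argSum-termArgs ch p K ((c , w , r) ∷ ts) x
      rewrite eval-residueGate ch (partner p) (cofactor p) (m≡partner*cofactor p) w r x
            | eval-residueGate ch (partner p) (cofactor p) (m≡partner*cofactor p) w (suc r) x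
            | argSum-termArgs ch p K ts x
      = distrib K (hits p w r y) (hits p w (suc r) y) (c mod′ p) ((- c) mod′ p) (residueSum p ts y)
      where
      y = λ i → eval (ch i) x
      distrib : ∀ K b₁ b₂ a b s → (if b₁ then K * a else 0) + ((if b₂ then K * b else 0) + K * s) ≡
                                  K * ((if b₁ then a else 0) + (if b₂ then b else 0) + s)
      distrib K b₁ b₂ a b s = trans (cong₂ (λ u v → u + (v + K * s)) (if-* b₁ a) (if-* b₂ b)) (solve K _ _ s)
        where
        if-* : ∀ b a → (if b then K * a else 0) ≡ K * (if b then a else 0)
        if-* true a = refl
        if-* false a = sym (ℕ.*-zeroʳ K)
        solve : ∀ K a b s → K * a + (K * b + K * s) ≡ K * (a + b + s)
        solve = ℕ-Solver.solve-∀

    argSum-++ : ∀ (cs ds : Args) x → argSum (cs ++ ds) x ≡ argSum cs x + argSum ds x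
    argSum-++ [] ds x = refl
    argSum-++ ((c , f) ∷ cs) ds x =
      trans (cong (_+_ (if eval f x then c else 0)) (argSum-++ cs ds x)) (sym (ℕ.+-assoc _ (argSum cs x) (argSum ds x)))

    primeArgs : (Fin N → Formula) → List ℕ → ℕ → Args
    primeArgs ch [] K = []
    primeArgs ch (p ∷ qs) K = termArgs ch p (K * product qs) (termsFor p) ++ primeArgs ch qs (K * p)

    residues : (Fin N → Bool) → ℕ → ℕ
    residues y p = residueSum p (termsFor p) y

    argSum-primeArgs : ∀ ch qs K x → argSum (primeArgs ch qs K) x ≡ K * combination (residues (λ i → eval (ch i) x)) qs
    argSum-primeArgs ch [] K x = sym (ℕ.*-zeroʳ K)
    argSum-primeArgs ch (p ∷ qs) K x = begin
        argSum (termArgs ch p (K * product qs) (termsFor p) ++ primeArgs ch qs (K * p)) x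
      ≡⟨ argSum-++ (termArgs ch p (K * product qs) (termsFor p)) (primeArgs ch qs (K * p)) x ⟩
        argSum (termArgs ch p (K * product qs) (termsFor p)) x + argSum (primeArgs ch qs (K * p)) x
      ≡⟨ cong₂ _+_ (argSum-termArgs ch p (K * product qs) (termsFor p) x) (argSum-primeArgs ch qs (K * p) x) ⟩
        K * product qs * residues y p + K * p * combination (residues y) qs
      ≡⟨ distrib K (product qs) (residues y p) p (combination (residues y) qs) ⟩
        K * combination (residues y) (p ∷ qs)
      ∎
      where
      open ≡-Reasoning
      y = λ i → eval (ch i) x
      distrib : ∀ K a b p s → K * a * b + K * p * s ≡ K * (a * b + p * s)
      distrib = ℕ-Solver.solve-∀

    product∣m : product ps ∣ m
    product∣m = product-∣ m unique allPrime allDivide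

    scale : ℕ
    scale = ℕ∣._∣_.quotient product∣m

    m≡scale*product : m ≡ scale * product ps
    m≡scale*product = ℕ∣._∣_.equality product∣m

    andGate : (Fin N → Formula) → Formula
    andGate ch = gate (acceptIf (λ a → ⌊ a ℕ.≟ 0 ⌋)) (primeArgs ch ps scale)

    eval-andGate : ∀ ch x → eval (andGate ch) x ≡ ⌊ (scale * combination (residues (λ i → eval (ch i) x)) ps) % m ℕ.≟ 0 ⌋
    eval-andGate ch x = trans (lookup-acceptIf (λ a → ⌊ a ℕ.≟ 0 ⌋) (argSum (primeArgs ch ps scale) x))
                              (cong (λ s → ⌊ s % m ℕ.≟ 0 ⌋) (argSum-primeArgs ch ps scale x))

    nonMultiple-∣ : ∀ p s → period p ∣ s → nonMultiple p s ≡ + 0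
    nonMultiple-∣ p s d with period p ∣? s
    ... | yes _ = refl
    ... | no ∤ = ⊥-elim (∤ d)

    nonMultiple-∤ : ∀ p s → ¬ period p ∣ s → nonMultiple p s ≡ + 1
    nonMultiple-∤ p s ∤ with period p ∣? s
    ... | yes d = ⊥-elim (∤ d)
    ... | no _ = refl

    nonMultiple-periodic : ∀ p s → nonMultiple p (s + period p) ≡ nonMultiple p s
    nonMultiple-periodic p s with period p ∣? s | period p ∣? (s + period p)
    ... | yes _ | yes _ = refl
    ... | no _ | no _ = refl
    ... | yes d | no ∤ = ⊥-elim (∤ (ℕ∣.∣m∣n⇒∣m+n d ℕ∣.∣-refl))
    ... | no ∤ | yes d = ⊥-elim (∤ (ℕ∣.∣m+n∣m⇒∣n (subst (period p ∣_) (ℕ.+-comm s (period p)) d) ℕ∣.∣-refl))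

    termsFor-sound : ∀ {p} → Prime p → ∀ y →
      + p ∣ℤ Modulo.termsValue (partner p) (termsFor p) y - + (partner p ^ period p) *ℤ nonMultiple p (zeros y)
    termsFor-sound {p} pr y =
      Modulo.representation-sound (partner p) (1<prime (partner-prime p)) N (period p) (nonMultiple p)
        (prime-∣-Δ^-periodic pr (ceilLog p R) (nonMultiple p) (nonMultiple-periodic p)) y

    residues-≡ : ∀ {p} → Prime p → ∀ y → + p ∣ℤ + residues y p - + (partner p ^ period p) *ℤ nonMultiple p (zeros y)
    residues-≡ {p} pr y =
      subst (_ ∣ℤ_) (telescope (+ residues y p) (Modulo.termsValue (partner p) (termsFor p) y) _)
        (ℤ∣.∣m∣n⇒∣m+n (residueSum-≡ p (ℕ.<⇒≤ (1<prime pr)) (termsFor p) y) (termsFor-sound pr y))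
      where
      telescope : ∀ x e c → x - e +ℤ (e - c) ≡ x - c
      telescope = ℤ-Solver.solve-∀

    period-∣⇒prime-∣-residues : ∀ {p} → Prime p → ∀ y → period p ∣ zeros y → p ∣ residues y p
    period-∣⇒prime-∣-residues {p} pr y d = ℤ∣.∣⇒∣ᵤ (subst (_ ∣ℤ_) (vanish (+ residues y p) (+ (partner p ^ period p)))
      (subst (λ z → + p ∣ℤ + residues y p - + (partner p ^ period p) *ℤ z) (nonMultiple-∣ p (zeros y) d) (residues-≡ pr y)))
      where
      vanish : ∀ x c → x - c *ℤ + 0 ≡ x
      vanish = ℤ-Solver.solve-∀

    prime-∣-residues⇒period-∣ : ∀ {p} → Prime p → ∀ y → p ∣ residues y p → period p ∣ zeros y
    prime-∣-residues⇒period-∣ {p} pr y d with period p ∣? zeros y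
    ... | yes d′ = d′
    ... | no ∤ = ⊥-elim (prime-∤-prime^ pr (partner-prime p) (partner-≢ p ∘ sym) (period p) (ℤ∣.∣⇒∣ᵤ p∣qᴾ))
      where
      p∣qᴾ : + p ∣ℤ + (partner p ^ period p)
      p∣qᴾ = subst (_ ∣ℤ_) (cancel (+ residues y p) (+ (partner p ^ period p)))
        (ℤ∣.∣m∣n⇒∣m-n (ℤ∣.∣ᵤ⇒∣ {+ p} {+ residues y p} d)
          (subst (λ z → + p ∣ℤ + residues y p - + (partner p ^ period p) *ℤ z) (nonMultiple-∤ p (zeros y) ∤) (residues-≡ pr y)))
        where
        cancel : ∀ x c → x - (x - c *ℤ + 1) ≡ c
        cancel = ℤ-Solver.solve-∀

    R^r≤product-periods : ∀ {qs} → All Prime qs → R ^ length qs ≤ product (powers (λ p → ceilLog p R) qs)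
    R^r≤product-periods [] = ℕ.≤-refl
    R^r≤product-periods {p ∷ _} (pr ∷ prs) =
      ℕ.*-mono-≤ (proj₁ (ceilLog-bounds p (1<prime pr) R)) (R^r≤product-periods prs)

    all-true⇒product-∣ : ∀ y → ANDₙ y ≡ true → product ps ∣ combination (residues y) ps
    all-true⇒product-∣ y allTrue = product-∣-combination (residues y) ps
      (All.map (λ {p} pr → period-∣⇒prime-∣-residues pr y (subst (period p ∣_) (sym (ANDₙ⇒zeros≡0 y allTrue)) (period p ℕ∣.∣0)))
               allPrime)

    product-∣⇒all-true : N < R ^ length ps → ∀ y → product ps ∣ combination (residues y) ps → ANDₙ y ≡ true
    product-∣⇒all-true N<Rʳ y ∣comb = zeros≡0⇒ANDₙ y (ℕ.n≤0⇒n≡0 (ℕ.≮⇒≥ (λ 0<zeros → ℕ.<-irrefl refl (begin-strict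
        N                                          <⟨ N<Rʳ ⟩
        R ^ length ps                              ≤⟨ R^r≤product-periods allPrime ⟩
        product (powers (λ p → ceilLog p R) ps)    ≤⟨ ℕ∣.∣⇒≤ {{ℕ.>-nonZero 0<zeros}} periods∣zeros ⟩
        zeros y                                    ≤⟨ zeros≤ y ⟩
        N                                          ∎))))
      where
      open ℕ.≤-Reasoning
      periods∣zeros : product (powers (λ p → ceilLog p R) ps) ∣ zeros y
      periods∣zeros = product-powers-∣ (λ p → ceilLog p R) (zeros y) unique allPrime
        (All.zipWith (λ (pr , p∣) → prime-∣-residues⇒period-∣ pr y p∣)
          (allPrime , combination-∣-product (residues y) unique allPrime ∣comb))

    eval-andGate≡ANDₙ : N < R ^ length ps → ∀ ch x → eval (andGate ch) x ≡ ANDₙ (λ i → eval (ch i) x)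
    eval-andGate≡ANDₙ N<Rʳ ch x = trans (eval-andGate ch x) (decide (ANDₙ y) refl)
      where
      instance scale≢0 : NonZero scale
      scale≢0 = ℕ.≢-nonZero λ scale≡0 → ℕ.≢-nonZero⁻¹ m (trans m≡scale*product (cong (_* product ps) scale≡0))
      y = λ i → eval (ch i) x
      S = combination (residues y) ps
      decide : ∀ b → ANDₙ y ≡ b → ⌊ (scale * S) % m ℕ.≟ 0 ⌋ ≡ b
      decide true allTrue = cong (λ r → ⌊ r ℕ.≟ 0 ⌋) (ℕ∣.n∣m⇒m%n≡0 (scale * S) m
        (subst (_∣ scale * S) (sym m≡scale*product) (ℕ∣.*-monoʳ-∣ scale (all-true⇒product-∣ y allTrue))))
      decide false notAll with (scale * S) % m ℕ.≟ 0
      ... | no _ = refl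
      ... | yes r≡0 = ⊥-elim (true≢false (trans (sym (product-∣⇒all-true N<Rʳ y product∣S)) notAll))
        where
        true≢false : true ≢ false
        true≢false ()
        product∣S : product ps ∣ S
        product∣S = ℕ∣.*-cancelˡ-∣ scale (subst (_∣ scale * S) m≡scale*product (ℕ∣.m%n≡0⇒n∣m (scale * S) m r≡0))

    All-primeArgs : ∀ (P : Formula → Set) ch → (∀ k w t → P (residueGate ch k w t)) →
      ∀ qs K → All (λ (_ , f) → P f) (primeArgs ch qs K)
    All-primeArgs P ch residue qs K = go qs K
      where
      terms : ∀ p K ts → All (λ (_ , f) → P f) (termArgs ch p K ts)
      terms p K [] = []
      terms p K ((c , w , r) ∷ ts) = residue _ w _ ∷ residue _ w _ ∷ terms p K ts
      go : ∀ qs K → All (λ (_ , f) → P f) (primeArgs ch qs K)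
      go [] K = []
      go (p ∷ qs) K = All.++⁺ (terms p (K * product qs) (termsFor p)) (go qs (K * p))

    length-termArgs : ∀ ch p K ts → length (termArgs ch p K ts) ≡ 2 * length ts
    length-termArgs ch p K [] = refl
    length-termArgs ch p K (_ ∷ ts) =
      trans (cong (λ l → ℕ.suc (ℕ.suc l)) (length-termArgs ch p K ts)) (sym (ℕ.*-suc 2 (length ts)))

    length-primeArgs : ∀ ch {qs} K → All Prime qs → All (_∣ m) qs →
      length (primeArgs ch qs K) ≤ length qs * (2 * (m * suc N) ^ (m * R + 1))
    length-primeArgs ch K [] [] = z≤n
    length-primeArgs ch {p ∷ qs} K (pr ∷ prs) (p∣m ∷ ∣m) = begin
        length (termArgs ch p K′ (termsFor p) ++ primeArgs ch qs (K * p))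
      ≡⟨ List.length-++ (termArgs ch p K′ (termsFor p)) ⟩
        length (termArgs ch p K′ (termsFor p)) + length (primeArgs ch qs (K * p))
      ≤⟨ ℕ.+-mono-≤ (ℕ.≤-trans (ℕ.≤-reflexive (length-termArgs ch p K′ (termsFor p))) (ℕ.*-monoʳ-≤ 2 length-termsFor))
                    (length-primeArgs ch (K * p) prs ∣m) ⟩
        2 * (m * suc N) ^ (m * R + 1) + length qs * (2 * (m * suc N) ^ (m * R + 1))
      ∎
      where
      open ℕ.≤-Reasoning
      K′ = K * product qs
      length-termsFor : length (termsFor p) ≤ (m * suc N) ^ (m * R + 1)
      length-termsFor = begin
        length (termsFor p)                   ≤⟨ Modulo.length-representation (partner p) N (period p) (nonMultiple p) ⟩
        (partner p * suc N) ^ period p        ≤⟨ ℕ.^-monoˡ-≤ (period p) (ℕ.*-monoˡ-≤ (suc N) (ℕ∣.∣⇒≤ (partner-∣ p))) ⟩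
        (m * suc N) ^ period p                ≤⟨ ℕ.^-monoʳ-≤ (m * suc N) {{ℕ.m*n≢0 m (suc N)}} period≤ ⟩
        (m * suc N) ^ (m * R + 1)             ∎
        where
        period≤ : period p ≤ m * R + 1
        period≤ = ℕ.≤-trans (proj₂ (ceilLog-bounds p (1<prime pr) R)) (ℕ.+-monoˡ-≤ 1 (ℕ.*-monoˡ-≤ R (ℕ∣.∣⇒≤ p∣m)))

    Σgates : (Fin N → Formula) → ℕ
    Σgates ch = ∑ (λ i → gateCount (ch i))

    gateCount-andGate : ∀ ch → gateCount (andGate ch) ≤ suc (argBound m N R (length ps) * suc (Σgates ch))
    gateCount-andGate ch = s≤s (begin
        argsGateCount (primeArgs ch ps scale)
      ≡⟨ argsGateCount-uniform (primeArgs ch ps scale)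
           (All-primeArgs (λ f → gateCount f ≡ suc (Σgates ch)) ch
             (λ k w t → cong suc (argsGateCount-children (λ i → w i * k) ch)) ps scale) ⟩
        length (primeArgs ch ps scale) * suc (Σgates ch)
      ≤⟨ ℕ.*-monoˡ-≤ (suc (Σgates ch)) (length-primeArgs ch scale allPrime allDivide) ⟩
        argBound m N R (length ps) * suc (Σgates ch)
      ∎)
      where open ℕ.≤-Reasoning

    formulaDepth-andGate : ∀ ch B → (∀ i → formulaDepth (ch i) ≤ B) → formulaDepth (andGate ch) ≤ 2 + B
    formulaDepth-andGate ch B below = s≤s (argsDepth-bound (primeArgs ch ps scale)
      (All-primeArgs (λ f → formulaDepth f ≤ suc B) ch
        (λ k w t → s≤s (argsDepth-bound (children (λ i → w i * k) ch) (All.tabulate⁺ below))) ps scale))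

module AndTrees where

  open import Defs
  open Compilation
  open AndGates
  open Estimates using (argBound; branching; 1≤^)
  open import Data.Nat using (ℕ; zero; suc; _+_; _*_; _^_; _≤_; _<_; z≤n; s≤s; NonZero)
  open import Data.Nat.Properties
  open import Data.Nat.Tactic.RingSolver using (solve-∀)
  open import Data.Bool using (Bool; true; false; _∧_)
  open import Data.Bool.Properties using (∧-assoc; ∧-identityʳ)
  open import Data.Fin using (Fin; zero; suc; _↑ˡ_; _↑ʳ_; combine)
  open import Data.List using (List; length)
  open import Data.Product using (∃; proj₁; proj₂)
  open import Function using (_∘_)
  open import Relation.Binary.PropositionalEquality

  ANDₙ-++ : ∀ a b (f : Fin (a + b) → Bool) → ANDₙ f ≡ ANDₙ (f ∘ (_↑ˡ b)) ∧ ANDₙ (f ∘ (a ↑ʳ_))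
  ANDₙ-++ zero b f = refl
  ANDₙ-++ (suc a) b f = trans (cong (f zero ∧_) (ANDₙ-++ a b (f ∘ suc))) (sym (∧-assoc (f zero) _ _))

  ANDₙ-combine : ∀ a b (f : Fin (a * b) → Bool) → ANDₙ f ≡ ANDₙ (λ i → ANDₙ (λ j → f (combine {a} {b} i j)))
  ANDₙ-combine zero b f = refl
  ANDₙ-combine (suc a) b f =
    trans (ANDₙ-++ b (a * b) f) (cong (ANDₙ (λ j → f (j ↑ˡ (a * b))) ∧_) (ANDₙ-combine a b (f ∘ (b ↑ʳ_))))

  ANDₙ-cong : ∀ {k} {f g : Fin k → Bool} → (∀ i → f i ≡ g i) → ANDₙ f ≡ ANDₙ g
  ANDₙ-cong {zero} _ = refl
  ANDₙ-cong {suc k} eq = cong₂ _∧_ (eq zero) (ANDₙ-cong (eq ∘ suc))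

  ANDₙ-true : ∀ {k} (y : Fin k → Bool) → ANDₙ y ≡ true → ∀ i → y i ≡ true
  ANDₙ-true {suc k} y eq i with y zero in y₀
  ANDₙ-true {suc k} y eq zero | true = y₀
  ANDₙ-true {suc k} y eq (suc i) | true = ANDₙ-true (y ∘ suc) eq i

  true-ANDₙ : ∀ {k} (y : Fin k → Bool) → (∀ i → y i ≡ true) → ANDₙ y ≡ true
  true-ANDₙ {zero} y _ = refl
  true-ANDₙ {suc k} y all rewrite all zero = true-ANDₙ (y ∘ suc) (all ∘ suc)

  ANDₙ-∘-surjection : ∀ {a b} (y : Fin a → Bool) (σ : Fin b → Fin a) → (∀ i → ∃ λ j → σ j ≡ i) →
    ANDₙ (y ∘ σ) ≡ ANDₙ y
  ANDₙ-∘-surjection y σ onto with ANDₙ y in eq | ANDₙ (y ∘ σ) in eqσ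
  ... | true | true = refl
  ... | false | false = refl
  ... | true | false = trans (sym eqσ) (true-ANDₙ (y ∘ σ) (λ j → ANDₙ-true y eq (σ j)))
  ... | false | true =
    trans (sym (true-ANDₙ y λ i → subst (λ k → y k ≡ true) (proj₂ (onto i)) (ANDₙ-true (y ∘ σ) eqσ (proj₁ (onto i))))) eq

  ∑-≤ : ∀ {k} (f : Fin k → ℕ) {B} → (∀ i → f i ≤ B) → ∑ f ≤ k * B
  ∑-≤ {zero} f _ = z≤n
  ∑-≤ {suc k} f le = +-mono-≤ (le zero) (∑-≤ (f ∘ suc) (le ∘ suc))

  size-step : ∀ A N X → 1 ≤ A → 1 ≤ X → suc (A * suc (N * X)) ≤ 2 * A * suc N * X
  size-step A N X 1≤A 1≤X = begin
      suc (A * suc (N * X))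
    ≡⟨ expand A N X ⟩
      1 + A + A * N * X
    ≤⟨ +-monoˡ-≤ (A * N * X) (+-mono-≤ (*-mono-≤ 1≤A 1≤X) (≤-trans (≤-reflexive (sym (*-identityʳ A))) (*-monoʳ-≤ A 1≤X))) ⟩
      A * X + A * X + A * N * X
    ≤⟨ m≤m+n _ (A * N * X) ⟩
      A * X + A * X + A * N * X + A * N * X
    ≡⟨ collect A N X ⟩
      2 * A * suc N * X
    ∎
    where
    open ≤-Reasoning
    expand : ∀ A N X → suc (A * suc (N * X)) ≡ 1 + A + A * N * X
    expand = solve-∀
    collect : ∀ A N X → A * X + A * X + A * N * X + A * N * X ≡ 2 * A * suc N * X
    collect = solve-∀

  module AndTree (m : ℕ) .{{_ : NonZero m}} (n : ℕ) {ps : List ℕ} (D : DistinctPrimeDivisors m ps)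
                 (N R : ℕ) (N<Rʳ : N < R ^ length ps) where

    open FormulaCompilation m n
    open Gadget m n D N R

    section : ∀ d → (Fin (N ^ suc d) → Formula) → Fin N → Fin (N ^ d) → Formula
    section d leaves i = leaves ∘ combine i

    andTree : (d : ℕ) → (Fin (N ^ d) → Formula) → Formula
    andTree zero leaves = leaves zero
    andTree (suc d) leaves = andGate (λ i → andTree d (section d leaves i))

    eval-andTree : ∀ d leaves x → eval (andTree d leaves) x ≡ ANDₙ (λ j → eval (leaves j) x)
    eval-andTree zero leaves x = sym (∧-identityʳ (eval (leaves zero) x))
    eval-andTree (suc d) leaves x = begin
        eval (andGate (λ i → andTree d (section d leaves i))) x
      ≡⟨ eval-andGate≡ANDₙ N<Rʳ _ x ⟩
        ANDₙ (λ i → eval (andTree d (section d leaves i)) x)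
      ≡⟨ ANDₙ-cong (λ i → eval-andTree d (section d leaves i) x) ⟩
        ANDₙ (λ i → ANDₙ (λ j → eval (section d leaves i j) x))
      ≡⟨ sym (ANDₙ-combine N (N ^ d) (λ j → eval (leaves j) x)) ⟩
        ANDₙ (λ j → eval (leaves j) x)
      ∎
      where open ≡-Reasoning

    formulaDepth-andTree : ∀ d leaves → (∀ j → formulaDepth (leaves j) ≡ 0) → formulaDepth (andTree d leaves) ≤ d * 2
    formulaDepth-andTree zero leaves flat = ≤-reflexive (flat zero)
    formulaDepth-andTree (suc d) leaves flat =
      formulaDepth-andGate _ (d * 2) (λ i → formulaDepth-andTree d (section d leaves i) (flat ∘ combine i))

    W = branching m N R (length ps)

    gateCount-andTree : 1 ≤ length ps → ∀ d leaves → (∀ j → gateCount (leaves j) ≡ 0) →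
      gateCount (andTree d leaves) ≤ W ^ d
    gateCount-andTree 1≤r zero leaves flat = ≤-trans (≤-reflexive (flat zero)) z≤n
    gateCount-andTree 1≤r (suc d) leaves flat = begin
        gateCount (andGate subtrees)
      ≤⟨ gateCount-andGate subtrees ⟩
        suc (A * suc (Σgates subtrees))
      ≤⟨ s≤s (*-monoʳ-≤ A (s≤s (∑-≤ (gateCount ∘ subtrees) λ i →
           gateCount-andTree 1≤r d (section d leaves i) (flat ∘ combine i)))) ⟩
        suc (A * suc (N * W ^ d))
      ≤⟨ size-step A N (W ^ d) 1≤A (1≤^ W d (*-mono-≤ (*-mono-≤ {1} {2} (s≤s z≤n) 1≤A) (s≤s {0} {N} z≤n))) ⟩
        W * W ^ d
      ∎
      where
      open ≤-Reasoning
      A = argBound m N R (length ps)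
      subtrees = λ i → andTree d (section d leaves i)
      1≤A : 1 ≤ A
      1≤A = *-mono-≤ 1≤r (*-mono-≤ {1} {2} (s≤s z≤n) (m^n>0 (m * suc N) {{m*n≢0 m (suc N)}} (m * R + 1)))

open import Defs
open import Data.Nat using (ℕ; zero; suc; _*_; _^_; _/_; _≤_; _<_; _≟_; z≤n; s≤s; NonZero; >-nonZero)
open import Data.Nat.Properties
open import Data.Nat.DivMod using (m/n*n≤m; m≥n⇒m/n>0)
open import Data.Nat.Divisibility using (_∣_; _∣?_)
open import Data.Nat.Logarithm using (⌈log₂_⌉)
open import Data.Nat.Primality using (Prime; prime?)
open import Data.Bool using (if_then_else_)
open import Data.Fin using (Fin; zero; toℕ; fromℕ<)
import Data.Fin.Properties as Fin
open import Data.List using (List; []; _∷_; length; filter; upTo)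
open import Data.List.Relation.Unary.All as All using (All; _∷_)
import Data.List.Relation.Unary.All.Properties as All
open import Data.List.Relation.Unary.AllPairs using (_∷_)
open import Data.List.Relation.Unary.Unique.Propositional using (Unique)
import Data.List.Relation.Unary.Unique.Propositional.Properties as Unique
open import Data.Product using (∃; Σ; _×_; _,_; proj₁; proj₂)
open import Data.Empty using (⊥-elim)
open import Function using (_∘_; _∘′_)
open import Relation.Binary.PropositionalEquality
open import Relation.Nullary using (yes; no)
open import Relation.Nullary.Decidable using (⌊_⌋; _×-dec_)
open Compilation
open AndGates
open AndTrees
open Estimates

distinctPrimeDivisors : ∀ {m ps} → Unique ps → All Prime ps → All (_∣ m) ps → 2 ≤ length ps →
  DistinctPrimeDivisors m ps
distinctPrimeDivisors {m} {q₁ ∷ q₂ ∷ _} u@((q₁≢q₂ ∷ _) ∷ _) pr@(pr₁ ∷ pr₂ ∷ _) dv@(d₁ ∷ d₂ ∷ _) _ = record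
  { unique = u ; allPrime = pr ; allDivide = dv
  ; partner = partner ; partner-prime = partner-prime ; partner-∣ = partner-∣ ; partner-≢ = partner-≢ }
  where
  partner : ℕ → ℕ
  partner p = if ⌊ p ≟ q₁ ⌋ then q₂ else q₁
  partner-prime : ∀ p → Prime (partner p)
  partner-prime p with p ≟ q₁
  ... | yes _ = pr₂
  ... | no _ = pr₁
  partner-∣ : ∀ p → partner p ∣ m
  partner-∣ p with p ≟ q₁
  ... | yes _ = d₂
  ... | no _ = d₁
  partner-≢ : ∀ p → partner p ≢ p
  partner-≢ p with p ≟ q₁
  ... | yes refl = q₁≢q₂ ∘′ sym
  ... | no p≢q₁ = p≢q₁ ∘′ sym
distinctPrimeDivisors {ps = []} _ _ _ ()
distinctPrimeDivisors {ps = _ ∷ []} _ _ _ (s≤s ())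

primeDivisors : ℕ → List ℕ
primeDivisors m = filter (λ p → prime? p ×-dec (p ∣? m)) (upTo (suc m))

primeDivisors-distinct : ∀ m → 2 ≤ ω m → DistinctPrimeDivisors m (primeDivisors m)
primeDivisors-distinct m 2≤ω = distinctPrimeDivisors
  (Unique.filter⁺ P? (Unique.upTo⁺ (suc m))) (All.map proj₁ both) (All.map proj₂ both) 2≤ω
  where
  P? = λ p → prime? p ×-dec (p ∣? m)
  both = All.all-filter P? (upTo (suc m))

surjection : ∀ {a b} → 0 < b → b ≤ a → Σ (Fin a → Fin b) λ σ → ∀ i → ∃ λ j → σ j ≡ i
surjection {a} {b} 0<b b≤a = σ , onto
  where
  σ : Fin a → Fin b
  σ j with toℕ j <? b
  ... | yes j<b = fromℕ< j<b
  ... | no _ = fromℕ< 0<b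
  onto : ∀ i → ∃ λ j → σ j ≡ i
  onto i = j , σj≡i
    where
    i<a = <-≤-trans (Fin.toℕ<n i) b≤a
    j = fromℕ< i<a
    σj≡i : σ j ≡ i
    σj≡i with toℕ j <? b
    ... | yes j<b = Fin.toℕ-injective (trans (Fin.toℕ-fromℕ< j<b) (Fin.toℕ-fromℕ< i<a))
    ... | no j≮b = ⊥-elim (j≮b (subst (_< b) (sym (Fin.toℕ-fromℕ< i<a)) (Fin.toℕ<n i)))

module Construction (m : ℕ) .{{_ : NonZero m}} {ps : List ℕ} (D : DistinctPrimeDivisors m ps) (1≤r : 1 ≤ length ps)
                    (K′ n′ : ℕ) (2≤n : 2 ≤ suc n′) where

  r = length ps
  K = suc K′
  n = suc n′
  L = ⌈log₂ n ⌉

  open FormulaCompilation m n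

  n≤2ᴸ : n ≤ 2 ^ L
  n≤2ᴸ = n≤2^⌈log₂n⌉ n

  1≤L : 1 ≤ L
  1≤L with L | n≤2ᴸ
  ... | zero | n≤1 = ⊥-elim (<-irrefl refl (<-≤-trans 2≤n n≤1))
  ... | suc _ | _ = s≤s z≤n

  N = proj₁ (integer-root K n′)
  n≤Nᴷ : n ≤ N ^ K
  n≤Nᴷ = proj₁ (proj₂ (integer-root K n′))
  Nᴷ≤ : N ^ K ≤ 2 ^ K * n
  Nᴷ≤ = proj₂ (proj₂ (integer-root K n′))
  1≤N : 1 ≤ N
  1≤N = 1≤base K n≤Nᴷ

  R = proj₁ (integer-root r {{>-nonZero 1≤r}} N)
  N<Rʳ : N < R ^ r
  N<Rʳ = proj₁ (proj₂ (integer-root r {{>-nonZero 1≤r}} N))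
  Rʳ≤ : R ^ r ≤ 2 ^ r * suc N
  Rʳ≤ = proj₂ (proj₂ (integer-root r {{>-nonZero 1≤r}} N))
  1≤R : 1 ≤ R
  1≤R = 1≤base r {{>-nonZero 1≤r}} N<Rʳ

  open AndTree m n D N R N<Rʳ
  open SizeBound m K r n L N R (s≤s z≤n) 1≤L 1≤N 1≤R n≤2ᴸ Nᴷ≤ Rʳ≤

  leaves-onto = surjection {N ^ K} {n} (s≤s z≤n) n≤Nᴷ
  leaf = proj₁ leaves-onto

  formula : Formula
  formula = andTree K (input ∘ leaf)

  eval-formula : ∀ x → eval formula x ≡ ANDₙ x
  eval-formula x = trans (eval-andTree K (input ∘ leaf) x)
                         (ANDₙ-∘-surjection x leaf (proj₂ leaves-onto))

  gateCount-formula : gateCount formula ≤ 2 ^ exponent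
  gateCount-formula = ≤-trans (gateCount-andTree 1≤r K (input ∘ leaf) (λ _ → refl)) Wᴷ≤2^exponent

  formulaDepth-formula : formulaDepth formula ≤ K * 2
  formulaDepth-formula = formulaDepth-andTree K (input ∘ leaf) (λ _ → refl)

  compiledFormula : Σ (Circuit m n) λ c → size c ≤ gateCount formula × depth c ≤ formulaDepth formula ×
                                          (∀ x → output c x ≡ eval formula x)
  compiledFormula = formulaCircuit formula

  andCircuit : Σ (Circuit m n) λ c → depth c ≤ K * 2 × Computes c ANDₙ ×
                 ∃ λ e → size c ≤ 2 ^ e × e ^ (r * K) ≤ sizeConstant m K r * n * L ^ (r * K)
  andCircuit with compiledFormula
  ... | c , size≤ , depth≤ , correct =
    c , ≤-trans depth≤ formulaDepth-formula , (λ x → trans (correct x) (eval-formula x)) ,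
    exponent , ≤-trans size≤ gateCount-formula , exponent-bound

ANDₙ-circuits : ∀ m .{{_ : NonZero m}} {ps} → DistinctPrimeDivisors m ps → 1 ≤ length ps →
  ∀ h K → 1 ≤ K → K * 2 ≤ h →
  ∃ λ C → (n : ℕ) → 2 ≤ n →
    Σ (Circuit m n) λ c → IsCC h c × Computes c ANDₙ ×
      ∃ λ e → size c ≤ 2 ^ e × e ^ (length ps * K) ≤ C * n * ⌈log₂ n ⌉ ^ (length ps * K)
ANDₙ-circuits m {ps} D 1≤r h (suc K′) _ 2K≤h = sizeConstant m (suc K′) (length ps) , λ where
  (suc n′) 2≤n → let open Construction m D 1≤r K′ n′ 2≤n in
                  let (c , depth≤ , rest) = andCircuit in
                  c , ≤-trans depth≤ 2K≤h , rest

proposition4p1 : (h m : ℕ) .{{_ : NonZero m}} → 2 ≤ h → 2 ≤ ω m →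
    ∃ λ (C : ℕ) → (n : ℕ) → 2 ≤ n →
      Σ (Circuit m n) λ c → IsCC h c × Computes c ANDₙ ×
        ∃ λ (e : ℕ) → size c ≤ 2 ^ e ×
          e ^ (ω m * (h / 2)) ≤ C * n * ⌈log₂ n ⌉ ^ (ω m * (h / 2))
proposition4p1 h m 2≤h 2≤ω =
  ANDₙ-circuits m (primeDivisors-distinct m 2≤ω) (≤-trans (s≤s z≤n) 2≤ω) h (h / 2) (m≥n⇒m/n>0 2≤h) (m/n*n≤m h 2)
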